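{- Let $(s_n)_{n\ge0}$ and $(t_n)_{n\ge0}$ be sequences of real numbers with $t_n\ne0$ for all $n$, and let $\alpha,\beta$ be indeterminates. Define polynomials $f_n(\alpha)$ by $f_{ -1}(\alpha)=0$, $f_0(\alpha)=1$ and $$f_n(\alpha)=(\alpha+s_{n-1})f_{n-1}(\alpha)-t_{n-2}f_{n-2}(\alpha),\quad n\ge1.$$ Define $m(n,k)$ for integers $n\ge0$, $k$ by $m(0,k)=[k=0]$, $m(n,k)=0$ for $k<0$, and $$m(n,k)=m(n-1,k-1)+s_k\,m(n-1,k)+t_k\,m(n-1,k+1),\quad n\ge1,\ k\ge0,$$ and set $m_n=m(n,0)$. Then for all positive integers $n$, $$\frac{\det\left(\alpha\beta m_{i+j}+(\alpha+\beta)m_{i+j+1}+m_{i+j+2}\right)_{i,j=0}^{n-1}}{\det\left(m_{i+j}\right)_{i,j=0}^{n-1}}=\sum_{j=0}^n f_j(\alpha)f_j(\beta)\prod_{\ell=j}^{n-1}t_\ell .$$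
   Context: $[\mathcal A]$ denotes the Iverson bracket ($1$ if $\mathcal A$ is true, $0$ otherwise). Combinatorially, $m(n,k)$ is the total weight of lattice paths from $(0,0)$ to $(n,k)$ with steps $(1,1)$, $(1,0)$, $(1,-1)$ never going below the $x$-axis, where an up-step has weight $1$, a horizontal step at height $h$ has weight $s_h$, and a down-step ending at height $h$ has weight $t_h$; the weight of a path is the product of its step weights. -}

module Defs where

open import Level using (Level; _⊔_) renaming (suc to lsuc)
open import Algebra.Bundles using (CommutativeRing)
open import Data.Nat using (ℕ; zero; suc)
open import Data.Fin using (Fin; toℕ; punchIn) renaming (zero to fzero; suc to fsuc)
open import Relation.Nullary using (¬_)

record Field (c ℓ : Level) : Set (lsuc (c ⊔ ℓ)) where
  field
    commutativeRing : CommutativeRing c ℓ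
  open CommutativeRing commutativeRing public
  field
    1≉0     : ¬ (1# ≈ 0#)
    inv     : (x : Carrier) → ¬ (x ≈ 0#) → Carrier
    inverse : (x : Carrier) (nz : ¬ (x ≈ 0#)) → x * inv x nz ≈ 1#

module Over {c ℓ : Level} (F : Field c ℓ) where
  open Field F using (Carrier; _+_; _*_; -_; _-_; 0#; 1#)

  sumFin : (n : ℕ) → (Fin n → Carrier) → Carrier
  sumFin zero    g = 0#
  sumFin (suc n) g = g fzero + sumFin n (λ i → g (fsuc i))

  prodRange : (ℕ → Carrier) → ℕ → ℕ → Carrier
  prodRange t j zero    = 1#
  prodRange t j (suc n) = prodRange t (suc j) n * t j

  sign : ℕ → Carrier
  sign zero    = 1#
  sign (suc k) = - sign k

  det : (n : ℕ) → (Fin n → Fin n → Carrier) → Carrier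
  det zero    M = 1#
  det (suc n) M =
    sumFin (suc n) (λ j → sign (toℕ j) * (M fzero j *
      det n (λ i k → M (fsuc i) (punchIn j k))))

  -- m(n,k) for k ≥ 0 (m(n,k) = 0 for k < 0 is built in: the k-1 term is
  -- dropped when k = 0)
  m : (s t : ℕ → Carrier) → ℕ → ℕ → Carrier
  m s t zero    zero    = 1#
  m s t zero    (suc k) = 0#
  m s t (suc n) zero    = s zero * m s t n zero + t zero * m s t n (suc zero)
  m s t (suc n) (suc k) =
    m s t n k + s (suc k) * m s t n (suc k) + t (suc k) * m s t n (suc (suc k))

  mom : (s t : ℕ → Carrier) → ℕ → Carrier
  mom s t n = m s t n zero

  -- f_n(α) for n ≥ 0 (f_{-1} = 0, so f_1 = (α + s_0) f_0)
  f : (s t : ℕ → Carrier) → Carrier → ℕ → Carrier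
  f s t α zero = 1#
  f s t α (suc zero) = (α + s zero) * 1#
  f s t α (suc (suc n)) = (α + s (suc n)) * f s t α (suc n) - t n * f s t α n

-- Write L = (m(i , k)), μ k = t 0 ⋯ t (k - 1), Δ = diag μ and J_γ for the tridiagonal
-- Jacobi matrix with γ + s p on the diagonal, 1 above and t p below, so that row i of L is
-- e₀ J₀ⁱ. Since J₀ is self-adjoint for the weights μ, m (i + j) = Σ_k m(i , k) μ k m(j , k):
-- the Hankel matrix is L Δ Lᵀ, with determinant Π μ k ≠ 0. In the same way the numerator is
-- W Δ Lᵀ, where W consists of the rows of L J_α J_β. Truncated to n × n, the product L J_α J_β
-- has determinant f n(α) f n(β), since det L = 1 and det J_γ = f n(γ) is a continuant, and it
-- differs from W only by t (n - 1) e_n in the last column. By multilinearity,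
-- det W_n = f n(α) f n(β) + t (n - 1) det W_{n-1}, which the claimed sum satisfies.

module Submission where

open import Defs
open import Level using (Level; _⊔_)
open import Algebra.Bundles using (CommutativeRing)
open import Algebra.Solver.Ring.AlmostCommutativeRing
  using (fromCommutativeRing; _-Raw-AlmostCommutative⟶_)
open import Data.Nat as ℕ using (ℕ; zero; suc; z≤n; s≤s; _≤_) renaming (_+_ to _+ℕ_; _∸_ to _∸ℕ_)
import Data.Nat.Properties as ℕ
open import Data.Integer as ℤ using (ℤ; +_; -[1+_]; _◃_; 0ℤ; 1ℤ)
import Data.Integer.Properties as ℤ
open import Data.Sign as Sign using (Sign)
open import Data.Fin as Fin using (Fin; toℕ; punchIn; punchOut; inject₁; fromℕ; fromℕ<)
  renaming (zero to fzero; suc to fsuc)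
open import Data.Fin.Properties
  using (toℕ<n; toℕ-inject₁; toℕ-fromℕ; fromℕ≢inject₁; toℕ-fromℕ<; toℕ-injective; suc-injective;
         punchInᵢ≢i; punchIn-punchOut; punchIn-injective)
open import Data.Maybe using (Maybe; just; nothing)
open import Data.Product using (Σ; _,_; proj₁; proj₂)
open import Data.Sum using (inj₁; inj₂)
open import Data.Empty using (⊥-elim)
open import Relation.Nullary using (¬_; yes; no)
open import Relation.Binary.PropositionalEquality as ≡ using (_≡_; _≢_)

-- Agda's ring solver needs a coefficient ring that computes; ℤ maps into every commutative ring.
module IntegerCoefficientSolver {c ℓ : Level} (R : CommutativeRing c ℓ) where
  open CommutativeRing R
  open import Algebra.Properties.Ring ring using (-‿distribˡ-*; -‿distribʳ-*)
  open import Algebra.Properties.AbelianGroup +-abelianGroup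
    using (⁻¹-involutive; ε⁻¹≈ε; ⁻¹-∙-comm)
  open import Algebra.Properties.Semiring.Mult.TCOptimised semiring using (_×_; 1+×; ×-homo-+; ×1-homo-*)
  open import Relation.Binary.Reasoning.Setoid setoid

  private
    ⟦_⟧ : ℤ → Carrier
    ⟦ + n ⟧      = n × 1#
    ⟦ -[1+ n ] ⟧ = - (suc n × 1#)

    n×1 : ℕ → Carrier
    n×1 n = n × 1#

    ⊖-homo : ∀ m n → ⟦ m ℤ.⊖ n ⟧ ≈ n×1 m - n×1 n
    ⊖-homo zero    zero    = sym (trans (+-congˡ ε⁻¹≈ε) (+-identityʳ 0#))
    ⊖-homo (suc m) zero    = sym (trans (+-congˡ ε⁻¹≈ε) (+-identityʳ _))
    ⊖-homo zero    (suc n) = sym (+-identityˡ _)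
    ⊖-homo (suc m) (suc n) = begin
      ⟦ suc m ℤ.⊖ suc n ⟧            ≡⟨ ≡.cong ⟦_⟧ (ℤ.[1+m]⊖[1+n]≡m⊖n m n) ⟩
      ⟦ m ℤ.⊖ n ⟧                    ≈⟨ ⊖-homo m n ⟩
      n×1 m - n×1 n                  ≈⟨ cancel (n×1 m) (n×1 n) ⟨
      (1# + n×1 m) - (1# + n×1 n)    ≈⟨ +-cong (1+× m 1#) (-‿cong (1+× n 1#)) ⟨
      n×1 (suc m) - n×1 (suc n)      ∎
      where
      cancel : ∀ a b → (1# + a) - (1# + b) ≈ a - b
      cancel a b = begin
        (1# + a) + - (1# + b)    ≈⟨ +-congˡ (sym (⁻¹-∙-comm 1# b)) ⟩
        (1# + a) + (- 1# + - b)  ≈⟨ +-congʳ (+-comm 1# a) ⟩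
        (a + 1#) + (- 1# + - b)  ≈⟨ +-assoc a 1# _ ⟩
        a + (1# + (- 1# + - b))  ≈⟨ +-congˡ (+-assoc 1# (- 1#) (- b)) ⟨
        a + ((1# - 1#) + - b)    ≈⟨ +-congˡ (+-congʳ (-‿inverseʳ 1#)) ⟩
        a + (0# + - b)           ≈⟨ +-congˡ (+-identityˡ (- b)) ⟩
        a - b                    ∎

    +-homo : ∀ i j → ⟦ i ℤ.+ j ⟧ ≈ ⟦ i ⟧ + ⟦ j ⟧
    +-homo (+ m)      (+ n)      = ×-homo-+ 1# m n
    +-homo (+ m)      -[1+ n ]   = ⊖-homo m (suc n)
    +-homo -[1+ m ]   (+ n)      = trans (⊖-homo n (suc m)) (+-comm _ _)
    +-homo -[1+ m ]   -[1+ n ]   = begin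
      - n×1 (suc (suc (m ℕ.+ n)))       ≡⟨ ≡.cong (λ k → - n×1 (suc k)) (ℕ.+-suc m n) ⟨
      - n×1 (suc m ℕ.+ suc n)           ≈⟨ -‿cong (×-homo-+ 1# (suc m) (suc n)) ⟩
      - (n×1 (suc m) + n×1 (suc n))     ≈⟨ ⁻¹-∙-comm _ _ ⟨
      - n×1 (suc m) + - n×1 (suc n)     ∎

    signed : Sign → Carrier → Carrier
    signed Sign.+ x = x
    signed Sign.- x = - x

    ◃-homo : ∀ s n → ⟦ s ◃ n ⟧ ≈ signed s (n×1 n)
    ◃-homo Sign.+ zero    = refl
    ◃-homo Sign.- zero    = sym ε⁻¹≈ε
    ◃-homo Sign.+ (suc n) = refl
    ◃-homo Sign.- (suc n) = refl

    signed-abs : ∀ i → ⟦ i ⟧ ≈ signed (ℤ.sign i) (n×1 ℤ.∣ i ∣)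
    signed-abs (+ n)    = refl
    signed-abs -[1+ n ] = refl

    signed-* : ∀ s r x y → signed (s Sign.* r) (x * y) ≈ signed s x * signed r y
    signed-* Sign.+ Sign.+ x y = refl
    signed-* Sign.+ Sign.- x y = -‿distribʳ-* x y
    signed-* Sign.- Sign.+ x y = -‿distribˡ-* x y
    signed-* Sign.- Sign.- x y = begin
      x * y          ≈⟨ ⁻¹-involutive (x * y) ⟨
      - - (x * y)    ≈⟨ -‿cong (-‿distribʳ-* x y) ⟩
      - (x * - y)    ≈⟨ -‿distribˡ-* x (- y) ⟩
      - x * - y      ∎

    *-homo : ∀ i j → ⟦ i ℤ.* j ⟧ ≈ ⟦ i ⟧ * ⟦ j ⟧
    *-homo i j = begin
      ⟦ ℤ.sign i Sign.* ℤ.sign j ◃ ℤ.∣ i ∣ ℕ.* ℤ.∣ j ∣ ⟧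
        ≈⟨ ◃-homo (ℤ.sign i Sign.* ℤ.sign j) (ℤ.∣ i ∣ ℕ.* ℤ.∣ j ∣) ⟩
      signed (ℤ.sign i Sign.* ℤ.sign j) (n×1 (ℤ.∣ i ∣ ℕ.* ℤ.∣ j ∣))
        ≈⟨ signed-cong (ℤ.sign i Sign.* ℤ.sign j) (×1-homo-* ℤ.∣ i ∣ ℤ.∣ j ∣) ⟩
      signed (ℤ.sign i Sign.* ℤ.sign j) (n×1 ℤ.∣ i ∣ * n×1 ℤ.∣ j ∣)
        ≈⟨ signed-* (ℤ.sign i) (ℤ.sign j) _ _ ⟩
      signed (ℤ.sign i) (n×1 ℤ.∣ i ∣) * signed (ℤ.sign j) (n×1 ℤ.∣ j ∣)
        ≈⟨ *-cong (signed-abs i) (signed-abs j) ⟨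
      ⟦ i ⟧ * ⟦ j ⟧ ∎
      where
      signed-cong : ∀ s {x y} → x ≈ y → signed s x ≈ signed s y
      signed-cong Sign.+ e = e
      signed-cong Sign.- e = -‿cong e

    -‿homo : ∀ i → ⟦ ℤ.- i ⟧ ≈ - ⟦ i ⟧
    -‿homo (+ zero)  = sym ε⁻¹≈ε
    -‿homo (+ suc n) = refl
    -‿homo -[1+ n ]  = sym (⁻¹-involutive _)

    morphism : ℤ.+-*-rawRing -Raw-AlmostCommutative⟶ fromCommutativeRing R
    morphism = record
      { ⟦_⟧ = ⟦_⟧ ; +-homo = +-homo ; *-homo = *-homo ; -‿homo = -‿homo
      ; 0-homo = refl ; 1-homo = refl }

    equal? : ∀ i j → Maybe (⟦ i ⟧ ≈ ⟦ j ⟧)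
    equal? i j with i ℤ.≟ j
    ... | yes ≡.refl = just refl
    ... | no _       = nothing

  open import Algebra.Solver.Ring ℤ.+-*-rawRing (fromCommutativeRing R) morphism equal? public

module _ {c ℓ : Level} (F : Field c ℓ) where
  open Field F
  open Over F
  open IntegerCoefficientSolver commutativeRing
  open import Relation.Binary.Reasoning.Setoid setoid
  open import Algebra.Properties.Ring ring using (-‿distribˡ-*)
  open import Algebra.Properties.AbelianGroup +-abelianGroup
    using (⁻¹-involutive; ε⁻¹≈ε; ⁻¹-∙-comm; inverseʳ-unique)

  -- Finite sums

  sumFin-cong : ∀ n {g h : Fin n → Carrier} → (∀ i → g i ≈ h i) → sumFin n g ≈ sumFin n h
  sumFin-cong zero    e = refl
  sumFin-cong (suc n) e = +-cong (e fzero) (sumFin-cong n (λ i → e (fsuc i)))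

  sumFin-zero : ∀ n {g : Fin n → Carrier} → (∀ i → g i ≈ 0#) → sumFin n g ≈ 0#
  sumFin-zero zero    e = refl
  sumFin-zero (suc n) e = trans (+-cong (e fzero) (sumFin-zero n (λ i → e (fsuc i)))) (+-identityˡ 0#)

  sumFin-+ : ∀ n (g h : Fin n → Carrier) →
             sumFin n (λ i → g i + h i) ≈ sumFin n g + sumFin n h
  sumFin-+ zero    g h = sym (+-identityˡ 0#)
  sumFin-+ (suc n) g h = trans (+-congˡ (sumFin-+ n _ _))
    (solve 4 (λ a b c d → (a :+ b) :+ (c :+ d) := (a :+ c) :+ (b :+ d)) refl _ _ _ _)

  *-distribˡ-sumFin : ∀ n x (g : Fin n → Carrier) → x * sumFin n g ≈ sumFin n (λ i → x * g i)
  *-distribˡ-sumFin zero    x g = zeroʳ x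
  *-distribˡ-sumFin (suc n) x g = trans (distribˡ _ _ _) (+-congˡ (*-distribˡ-sumFin n x _))

  sumFin-neg : ∀ n (g : Fin n → Carrier) → sumFin n (λ i → - g i) ≈ - sumFin n g
  sumFin-neg zero    g = sym ε⁻¹≈ε
  sumFin-neg (suc n) g = trans (+-congˡ (sumFin-neg n _)) (⁻¹-∙-comm _ _)

  sumFin-comm : ∀ n m (g : Fin n → Fin m → Carrier) →
    sumFin n (λ i → sumFin m (g i)) ≈ sumFin m (λ j → sumFin n (λ i → g i j))
  sumFin-comm zero    m g = sym (sumFin-zero m (λ _ → refl))
  sumFin-comm (suc n) m g = trans (+-congˡ (sumFin-comm n m (λ i → g (fsuc i))))
                                  (sym (sumFin-+ m _ _))

  sumFin-last : ∀ n (g : Fin (suc n) → Carrier) →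
    sumFin (suc n) g ≈ sumFin n (λ i → g (inject₁ i)) + g (fromℕ n)
  sumFin-last zero    g = +-comm _ _
  sumFin-last (suc n) g = trans (+-congˡ (sumFin-last n (λ i → g (fsuc i)))) (sym (+-assoc _ _ _))

  sumℕ : ℕ → (ℕ → Carrier) → Carrier
  sumℕ zero    g = 0#
  sumℕ (suc n) g = sumℕ n g + g n

  sumℕ-cong< : ∀ n {g h : ℕ → Carrier} → (∀ i → i ℕ.< n → g i ≈ h i) → sumℕ n g ≈ sumℕ n h
  sumℕ-cong< zero    e = refl
  sumℕ-cong< (suc n) e = +-cong (sumℕ-cong< n (λ i i<n → e i (ℕ.m<n⇒m<1+n i<n))) (e n ℕ.≤-refl)

  sumℕ-cong : ∀ n {g h : ℕ → Carrier} → (∀ i → g i ≈ h i) → sumℕ n g ≈ sumℕ n h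
  sumℕ-cong n e = sumℕ-cong< n (λ i _ → e i)

  sumℕ-zero< : ∀ n {g : ℕ → Carrier} → (∀ i → i ℕ.< n → g i ≈ 0#) → sumℕ n g ≈ 0#
  sumℕ-zero< zero    e = refl
  sumℕ-zero< (suc n) e =
    trans (+-cong (sumℕ-zero< n (λ i i<n → e i (ℕ.m<n⇒m<1+n i<n))) (e n ℕ.≤-refl)) (+-identityˡ 0#)

  sumℕ-head : ∀ n (g : ℕ → Carrier) → sumℕ (suc n) g ≈ g 0 + sumℕ n (λ k → g (suc k))
  sumℕ-head zero    g = trans (+-identityˡ _) (sym (+-identityʳ _))
  sumℕ-head (suc n) g = trans (+-congʳ (sumℕ-head n g)) (+-assoc _ _ _)

  sumℕ-+ : ∀ n (g h : ℕ → Carrier) → sumℕ n (λ i → g i + h i) ≈ sumℕ n g + sumℕ n h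
  sumℕ-+ zero    g h = sym (+-identityˡ 0#)
  sumℕ-+ (suc n) g h = trans (+-congʳ (sumℕ-+ n g h))
    (solve 4 (λ a b c d → (a :+ b) :+ (c :+ d) := (a :+ c) :+ (b :+ d)) refl _ _ _ _)

  *-distribˡ-sumℕ : ∀ n x (g : ℕ → Carrier) → x * sumℕ n g ≈ sumℕ n (λ i → x * g i)
  *-distribˡ-sumℕ zero    x g = zeroʳ x
  *-distribˡ-sumℕ (suc n) x g = trans (distribˡ _ _ _) (+-congʳ (*-distribˡ-sumℕ n x _))

  sumFin-toℕ : ∀ n (g : ℕ → Carrier) → sumFin n (λ i → g (toℕ i)) ≈ sumℕ n g
  sumFin-toℕ zero    g = refl
  sumFin-toℕ (suc n) g = trans (+-congˡ (sumFin-toℕ n (λ k → g (suc k)))) (sym (sumℕ-head n g))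

  prodRange-suc : ∀ (t : ℕ → Carrier) j k → prodRange t j (suc k) ≈ prodRange t j k * t (j +ℕ k)
  prodRange-suc t j zero    = *-congˡ (reflexive (≡.cong t (≡.sym (ℕ.+-identityʳ j))))
  prodRange-suc t j (suc k) = begin
    prodRange t (suc j) (suc k) * t j               ≈⟨ *-congʳ (prodRange-suc t (suc j) k) ⟩
    prodRange t (suc j) k * t (suc j +ℕ k) * t j    ≈⟨ solve 3 (λ p x y → p :* x :* y := p :* y :* x) refl _ _ _ ⟩
    prodRange t (suc j) k * t j * t (suc j +ℕ k)    ≡⟨ ≡.cong (λ z → prodRange t (suc j) k * t j * t z) (ℕ.+-suc j k) ⟨
    prodRange t j (suc k) * t (j +ℕ suc k)          ∎

  prodFin : ∀ n → (Fin n → Carrier) → Carrier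
  prodFin zero    g = 1#
  prodFin (suc n) g = g fzero * prodFin n (λ i → g (fsuc i))

  prodFin-cong : ∀ n {g h : Fin n → Carrier} → (∀ i → g i ≈ h i) → prodFin n g ≈ prodFin n h
  prodFin-cong zero    e = refl
  prodFin-cong (suc n) e = *-cong (e fzero) (prodFin-cong n (λ i → e (fsuc i)))

  prodFin-1 : ∀ n {g : Fin n → Carrier} → (∀ i → g i ≈ 1#) → prodFin n g ≈ 1#
  prodFin-1 zero    e = refl
  prodFin-1 (suc n) e = trans (*-cong (e fzero) (prodFin-1 n (λ i → e (fsuc i)))) (*-identityˡ 1#)

  -- Determinants

  Matrix : ℕ → Set c
  Matrix n = Fin n → Fin n → Carrier

  minor : ∀ {n} → Matrix (suc n) → Fin (suc n) → Matrix n
  minor M j a b = M (fsuc a) (punchIn j b)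

  expansionTerm : ∀ {n} → Matrix (suc n) → Fin (suc n) → Carrier
  expansionTerm {n} M j = sign (toℕ j) * (M fzero j * det n (minor M j))

  det-cong : ∀ n {M N : Matrix n} → (∀ i j → M i j ≈ N i j) → det n M ≈ det n N
  det-cong zero    e = refl
  det-cong (suc n) {M} {N} e = sumFin-cong (suc n) {expansionTerm M} {expansionTerm N} λ j →
    *-congˡ (*-cong (e fzero j) (det-cong n (λ a b → e (fsuc a) (punchIn j b))))

  det-linear : ∀ n (A B C : Matrix n) (r : Fin n) x →
    (∀ i j → j ≢ r → A i j ≈ B i j) → (∀ i j → j ≢ r → A i j ≈ C i j) →
    (∀ i → A i r ≈ B i r + x * C i r) → det n A ≈ det n B + x * det n C
  det-linear (suc n) A B C r x A≈B A≈C Aᵣ = begin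
    sumFin (suc n) (expansionTerm A)
      ≈⟨ sumFin-cong (suc n) term ⟩
    sumFin (suc n) (λ j → expansionTerm B j + x * expansionTerm C j)
      ≈⟨ sumFin-+ (suc n) (expansionTerm B) (λ j → x * expansionTerm C j) ⟩
    det (suc n) B + sumFin (suc n) (λ j → x * expansionTerm C j)
      ≈⟨ +-congˡ (*-distribˡ-sumFin (suc n) x (expansionTerm C)) ⟨
    det (suc n) B + x * det (suc n) C ∎
    where
    term : ∀ j → expansionTerm A j ≈ expansionTerm B j + x * expansionTerm C j
    term j with j Fin.≟ r
    ... | yes ≡.refl =
      trans (*-congˡ (*-cong (Aᵣ fzero) (det-cong n (λ a b → A≈B (fsuc a) _ (punchInᵢ≢i j b)))))
      (trans (solve 5 (λ s b x c d → s :* ((b :+ x :* c) :* d) := s :* (b :* d) :+ x :* (s :* (c :* d)))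
                refl _ _ _ _ _)
             (+-congˡ (*-congˡ (*-congˡ (*-congˡ
               (det-cong n (λ a b → trans (sym (A≈B (fsuc a) _ (punchInᵢ≢i j b)))
                                          (A≈C (fsuc a) _ (punchInᵢ≢i j b)))))))))
    ... | no j≢r =
      trans (*-congˡ (*-congˡ minorLinear))
      (trans (solve 5 (λ s a x d e → s :* (a :* (d :+ x :* e)) := s :* (a :* d) :+ x :* (s :* (a :* e)))
                refl _ _ _ _ _)
             (+-cong (*-congˡ (*-congʳ (A≈B fzero j j≢r)))
                     (*-congˡ (*-congˡ (*-congʳ (A≈C fzero j j≢r))))))
      where
      r′ = punchOut j≢r
      avoids : ∀ b → b ≢ r′ → punchIn j b ≢ r
      avoids b b≢r′ e = b≢r′ (punchIn-injective j b r′ (≡.trans e (≡.sym (punchIn-punchOut j≢r))))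
      minorLinear = det-linear n (minor A j) (minor B j) (minor C j) r′ x
        (λ a b b≢ → A≈B _ _ (avoids b b≢)) (λ a b b≢ → A≈C _ _ (avoids b b≢))
        (λ a → ≡.subst (λ z → A (fsuc a) z ≈ B (fsuc a) z + x * C (fsuc a) z)
                        (≡.sym (punchIn-punchOut j≢r)) (Aᵣ (fsuc a)))

  adjSwap : ∀ {n} → Fin n → Fin (suc n) → Fin (suc n)
  adjSwap fzero    fzero               = fsuc fzero
  adjSwap fzero    (fsuc fzero)        = fzero
  adjSwap fzero    (fsuc (fsuc b))     = fsuc (fsuc b)
  adjSwap (fsuc k) fzero               = fzero
  adjSwap (fsuc k) (fsuc b)            = fsuc (adjSwap k b)

  adjSwap-inject₁ : ∀ {n} (k : Fin n) → adjSwap k (inject₁ k) ≡ fsuc k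
  adjSwap-inject₁ fzero    = ≡.refl
  adjSwap-inject₁ (fsuc k) = ≡.cong fsuc (adjSwap-inject₁ k)

  adjSwap-suc : ∀ {n} (k : Fin n) → adjSwap k (fsuc k) ≡ inject₁ k
  adjSwap-suc fzero    = ≡.refl
  adjSwap-suc (fsuc k) = ≡.cong fsuc (adjSwap-suc k)

  adjSwap-other : ∀ {n} (k : Fin n) j → j ≢ inject₁ k → j ≢ fsuc k → adjSwap k j ≡ j
  adjSwap-other fzero    fzero               j≢k  _    = ⊥-elim (j≢k ≡.refl)
  adjSwap-other fzero    (fsuc fzero)        _    j≢k₁ = ⊥-elim (j≢k₁ ≡.refl)
  adjSwap-other fzero    (fsuc (fsuc j))     _    _    = ≡.refl
  adjSwap-other (fsuc k) fzero               _    _    = ≡.refl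
  adjSwap-other (fsuc k) (fsuc j)            j≢k  j≢k₁ =
    ≡.cong fsuc (adjSwap-other k j (λ e → j≢k (≡.cong fsuc e)) (λ e → j≢k₁ (≡.cong fsuc e)))

  adjSwap-punchIn-inject₁ : ∀ {n} (k : Fin n) b →
    adjSwap k (punchIn (inject₁ k) b) ≡ punchIn (fsuc k) b
  adjSwap-punchIn-inject₁ fzero    fzero    = ≡.refl
  adjSwap-punchIn-inject₁ fzero    (fsuc b) = ≡.refl
  adjSwap-punchIn-inject₁ (fsuc k) fzero    = ≡.refl
  adjSwap-punchIn-inject₁ (fsuc k) (fsuc b) = ≡.cong fsuc (adjSwap-punchIn-inject₁ k b)

  adjSwap-punchIn-suc : ∀ {n} (k : Fin n) b →
    adjSwap k (punchIn (fsuc k) b) ≡ punchIn (inject₁ k) b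
  adjSwap-punchIn-suc fzero    fzero    = ≡.refl
  adjSwap-punchIn-suc fzero    (fsuc b) = ≡.refl
  adjSwap-punchIn-suc (fsuc k) fzero    = ≡.refl
  adjSwap-punchIn-suc (fsuc k) (fsuc b) = ≡.cong fsuc (adjSwap-punchIn-suc k b)

  adjSwap-punchIn-other : ∀ {n} (k : Fin (suc n)) j → j ≢ inject₁ k → j ≢ fsuc k →
    Σ (Fin n) λ k′ → ∀ b → adjSwap k (punchIn j b) ≡ punchIn j (adjSwap k′ b)
  adjSwap-punchIn-other fzero fzero j≢k _ = ⊥-elim (j≢k ≡.refl)
  adjSwap-punchIn-other (fsuc k) fzero _ _ = k , λ b → ≡.refl
  adjSwap-punchIn-other fzero (fsuc fzero) _ j≢k₁ = ⊥-elim (j≢k₁ ≡.refl)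
  adjSwap-punchIn-other {suc n} fzero (fsuc (fsuc j)) _ _ = fzero , commute
    where
    commute : ∀ b → adjSwap fzero (punchIn (fsuc (fsuc j)) b) ≡ punchIn (fsuc (fsuc j)) (adjSwap fzero b)
    commute fzero           = ≡.refl
    commute (fsuc fzero)    = ≡.refl
    commute (fsuc (fsuc b)) = ≡.refl
  adjSwap-punchIn-other {suc n} (fsuc k) (fsuc j) j≢k j≢k₁ =
    let k′ , commute = adjSwap-punchIn-other k j (λ e → j≢k (≡.cong fsuc e)) (λ e → j≢k₁ (≡.cong fsuc e))
    in fsuc k′ , λ { fzero → ≡.refl ; (fsuc b) → ≡.cong fsuc (commute b) }

  sumFin-adjSwap : ∀ {n} (k : Fin n) (g : Fin (suc n) → Carrier) →
    sumFin (suc n) (λ j → g (adjSwap k j)) ≈ sumFin (suc n) g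
  sumFin-adjSwap {suc n} fzero    g = solve 3 (λ a b c → a :+ (b :+ c) := b :+ (a :+ c)) refl _ _ _
  sumFin-adjSwap {suc n} (fsuc k) g = +-congˡ (sumFin-adjSwap k (λ j → g (fsuc j)))

  sign-inject₁ : ∀ {n} (k : Fin n) → sign (toℕ (inject₁ k)) ≈ sign (toℕ k)
  sign-inject₁ k = reflexive (≡.cong sign (toℕ-inject₁ k))

  det-adjSwap : ∀ n (A B : Matrix (suc n)) (k : Fin n) →
    (∀ i j → A i j ≈ B i (adjSwap k j)) → det (suc n) A ≈ - det (suc n) B
  det-adjSwap (suc n) A B k A≈B = begin
    sumFin (suc (suc n)) (expansionTerm A)
      ≈⟨ sumFin-cong (suc (suc n)) term ⟩
    sumFin (suc (suc n)) (λ j → - expansionTerm B (adjSwap k j))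
      ≈⟨ sumFin-neg (suc (suc n)) (λ j → expansionTerm B (adjSwap k j)) ⟩
    - sumFin (suc (suc n)) (λ j → expansionTerm B (adjSwap k j))
      ≈⟨ -‿cong (sumFin-adjSwap k (expansionTerm B)) ⟩
    - det (suc (suc n)) B ∎
    where
    A≈B′ : ∀ i {j j′} → adjSwap k j ≡ j′ → A i j ≈ B i j′
    A≈B′ i e = trans (A≈B i _) (reflexive (≡.cong (B i) e))
    term : ∀ j → expansionTerm A j ≈ - expansionTerm B (adjSwap k j)
    term j with j Fin.≟ inject₁ k | j Fin.≟ fsuc k
    ... | yes ≡.refl | _ = begin
      sign (toℕ (inject₁ k)) * (A fzero (inject₁ k) * det (suc n) (minor A (inject₁ k)))
        ≈⟨ *-cong (sign-inject₁ k) (*-cong (A≈B′ fzero (adjSwap-inject₁ k))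
             (det-cong (suc n) (λ a b → A≈B′ (fsuc a) (adjSwap-punchIn-inject₁ k b)))) ⟩
      sign (toℕ k) * (B fzero (fsuc k) * det (suc n) (minor B (fsuc k)))
        ≈⟨ solve 3 (λ s a d → s :* (a :* d) := :- ((:- s) :* (a :* d))) refl _ _ _ ⟩
      - expansionTerm B (fsuc k)
        ≡⟨ ≡.cong (λ z → - expansionTerm B z) (adjSwap-inject₁ k) ⟨
      - expansionTerm B (adjSwap k (inject₁ k)) ∎
    ... | no _ | yes ≡.refl = begin
      - sign (toℕ k) * (A fzero (fsuc k) * det (suc n) (minor A (fsuc k)))
        ≈⟨ *-cong (-‿cong (sym (sign-inject₁ k))) (*-cong (A≈B′ fzero (adjSwap-suc k))
             (det-cong (suc n) (λ a b → A≈B′ (fsuc a) (adjSwap-punchIn-suc k b)))) ⟩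
      - sign (toℕ (inject₁ k)) * (B fzero (inject₁ k) * det (suc n) (minor B (inject₁ k)))
        ≈⟨ -‿distribˡ-* _ _ ⟨
      - expansionTerm B (inject₁ k)
        ≡⟨ ≡.cong (λ z → - expansionTerm B z) (adjSwap-suc k) ⟨
      - expansionTerm B (adjSwap k (fsuc k)) ∎
    ... | no j≢k | no j≢k₁ = begin
      sign (toℕ j) * (A fzero j * det (suc n) (minor A j))
        ≈⟨ *-congˡ (*-cong (A≈B′ fzero (adjSwap-other k j j≢k j≢k₁))
             (det-adjSwap n (minor A j) (minor B j) k′ (λ a b → A≈B′ (fsuc a) (commute b)))) ⟩
      sign (toℕ j) * (B fzero j * - det (suc n) (minor B j))
        ≈⟨ solve 3 (λ s a d → s :* (a :* (:- d)) := :- (s :* (a :* d))) refl _ _ _ ⟩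
      - expansionTerm B j
        ≡⟨ ≡.cong (λ z → - expansionTerm B z) (adjSwap-other k j j≢k j≢k₁) ⟨
      - expansionTerm B (adjSwap k j) ∎
      where
      k′ = proj₁ (adjSwap-punchIn-other k j j≢k j≢k₁)
      commute = proj₂ (adjSwap-punchIn-other k j j≢k j≢k₁)

  sumFin-pair : ∀ {n} (k : Fin n) (g : Fin (suc n) → Carrier) →
    g (inject₁ k) + g (fsuc k) ≈ 0# → (∀ j → j ≢ inject₁ k → j ≢ fsuc k → g j ≈ 0#) →
    sumFin (suc n) g ≈ 0#
  sumFin-pair {suc n} fzero g pair rest = begin
    g fzero + (g (fsuc fzero) + sumFin n (λ j → g (fsuc (fsuc j))))
      ≈⟨ +-congˡ (+-congˡ (sumFin-zero n (λ j → rest _ (λ ()) (λ ())))) ⟩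
    g fzero + (g (fsuc fzero) + 0#)  ≈⟨ +-congˡ (+-identityʳ _) ⟩
    g fzero + g (fsuc fzero)         ≈⟨ pair ⟩
    0#                               ∎
  sumFin-pair {suc n} (fsuc k) g pair rest =
    trans (+-cong (rest fzero (λ ()) (λ ()))
                  (sumFin-pair k (λ j → g (fsuc j)) pair
                    (λ j j≢k j≢k₁ → rest (fsuc j) (λ e → j≢k (suc-injective e)) (λ e → j≢k₁ (suc-injective e)))))
          (+-identityˡ 0#)

  det-adjacentEqualColumns : ∀ n (M : Matrix (suc n)) (k : Fin n) →
    (∀ i → M i (inject₁ k) ≈ M i (fsuc k)) → det (suc n) M ≈ 0#
  det-adjacentEqualColumns (suc n) M k Mₖ≈Mₖ₁ = sumFin-pair k (expansionTerm M) pair others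
    where
    swapInvariant : ∀ i b → M i b ≈ M i (adjSwap k b)
    swapInvariant i b with b Fin.≟ inject₁ k | b Fin.≟ fsuc k
    ... | yes ≡.refl | _ = trans (Mₖ≈Mₖ₁ i) (reflexive (≡.cong (M i) (≡.sym (adjSwap-inject₁ k))))
    ... | no _ | yes ≡.refl = trans (sym (Mₖ≈Mₖ₁ i)) (reflexive (≡.cong (M i) (≡.sym (adjSwap-suc k))))
    ... | no b≢k | no b≢k₁ = reflexive (≡.cong (M i) (≡.sym (adjSwap-other k b b≢k b≢k₁)))
    pair : expansionTerm M (inject₁ k) + expansionTerm M (fsuc k) ≈ 0#
    pair = begin
      sign (toℕ (inject₁ k)) * (M fzero (inject₁ k) * det (suc n) (minor M (inject₁ k)))
        + expansionTerm M (fsuc k)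
        ≈⟨ +-congʳ (*-cong (sign-inject₁ k) (*-cong (Mₖ≈Mₖ₁ fzero) (det-cong (suc n) λ a b →
             trans (swapInvariant _ _) (reflexive (≡.cong (M (fsuc a)) (adjSwap-punchIn-inject₁ k b)))))) ⟩
      sign (toℕ k) * (M fzero (fsuc k) * det (suc n) (minor M (fsuc k)))
        + - sign (toℕ k) * (M fzero (fsuc k) * det (suc n) (minor M (fsuc k)))
        ≈⟨ solve 3 (λ s a d → s :* (a :* d) :+ (:- s) :* (a :* d) := con 0ℤ) refl _ _ _ ⟩
      0# ∎
    others : ∀ j → j ≢ inject₁ k → j ≢ fsuc k → expansionTerm M j ≈ 0#
    others j j≢k j≢k₁ = trans (*-congˡ (*-congˡ minorVanishes)) (trans (*-congˡ (zeroʳ _)) (zeroʳ _))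
      where
      k′ = proj₁ (adjSwap-punchIn-other k j j≢k j≢k₁)
      commute = proj₂ (adjSwap-punchIn-other k j j≢k j≢k₁)
      minorVanishes = det-adjacentEqualColumns n (minor M j) k′ λ a →
        trans (swapInvariant _ _) (reflexive (≡.cong (M (fsuc a))
          (≡.trans (commute (inject₁ k′)) (≡.cong (punchIn j) (adjSwap-inject₁ k′)))))

  -- Moving column q leftwards by adjacent swaps until it meets column p; fuel d bounds q.
  det-equalColumns′ : ∀ d n (M : Matrix n) (p q : Fin n) → toℕ q ℕ.≤ d → toℕ p ℕ.< toℕ q →
    (∀ i → M i p ≈ M i q) → det n M ≈ 0#
  det-equalColumns′ d       (suc n) M p fzero    _        ()
  det-equalColumns′ (suc d) (suc n) M p (fsuc k) (s≤s q≤d) p<q Mₚ≈M_q with p Fin.≟ inject₁ k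
  ... | yes ≡.refl = det-adjacentEqualColumns n M k Mₚ≈M_q
  ... | no p≢k = begin
    det (suc n) M        ≈⟨ ⁻¹-involutive _ ⟨
    - - det (suc n) M    ≈⟨ -‿cong (det-adjSwap n N M k (λ i j → refl)) ⟨
    - det (suc n) N      ≈⟨ -‿cong swappedVanishes ⟩
    - 0#                 ≈⟨ ε⁻¹≈ε ⟩
    0#                   ∎
    where
    N : Matrix (suc n)
    N i j = M i (adjSwap k j)
    p<k : toℕ p ℕ.< toℕ k
    p<k = ℕ.≤∧≢⇒< (ℕ.≤-pred p<q) (λ e → p≢k (toℕ-injective (≡.trans e (≡.sym (toℕ-inject₁ k)))))
    p≢k₁ : p ≢ fsuc k
    p≢k₁ e = ℕ.<-irrefl (≡.cong toℕ e) (ℕ.m<n⇒m<1+n p<k)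
    swappedVanishes : det (suc n) N ≈ 0#
    swappedVanishes = det-equalColumns′ d (suc n) N p (inject₁ k)
      (≡.subst (ℕ._≤ d) (≡.sym (toℕ-inject₁ k)) q≤d)
      (≡.subst (toℕ p ℕ.<_) (≡.sym (toℕ-inject₁ k)) p<k)
      (λ i → trans (reflexive (≡.cong (M i) (adjSwap-other k p p≢k p≢k₁)))
             (trans (Mₚ≈M_q i) (reflexive (≡.cong (M i) (≡.sym (adjSwap-inject₁ k))))))

  det-equalColumns : ∀ n (M : Matrix n) (p q : Fin n) → toℕ p ℕ.< toℕ q →
    (∀ i → M i p ≈ M i q) → det n M ≈ 0#
  det-equalColumns n M p q = det-equalColumns′ (toℕ q) n M p q ℕ.≤-refl

  firstColumnExpansion : ∀ n → Matrix (suc n) → Carrier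
  firstColumnExpansion n M =
    sumFin (suc n) (λ i → sign (toℕ i) * (M i fzero * det n (λ a b → M (punchIn i a) (fsuc b))))

  -- Both sides expand, after one more step, into the same double sum over (i , j).
  det-firstColumnExpansion : ∀ n (M : Matrix (suc n)) → firstColumnExpansion n M ≈ det (suc n) M
  det-firstColumnExpansion zero    M = refl
  det-firstColumnExpansion (suc n) M = +-congˡ (begin
    sumFin (suc n) (λ i → - sign (toℕ i) * (M (fsuc i) fzero *
      sumFin (suc n) (λ j → sign (toℕ j) * (M fzero (fsuc j) * det n (D i j)))))
      ≈⟨ sumFin-cong (suc n) (λ i → trans
           (scaleSum (- sign (toℕ i)) (M (fsuc i) fzero) (λ j → sign (toℕ j) * (M fzero (fsuc j) * det n (D i j))))
           (sumFin-cong (suc n) (λ j →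
             rowFirst (sign (toℕ i)) (sign (toℕ j)) (M (fsuc i) fzero) (M fzero (fsuc j)) (det n (D i j))))) ⟩
    sumFin (suc n) (λ i → sumFin (suc n) (λ j → T i j))
      ≈⟨ sumFin-comm (suc n) (suc n) T ⟩
    sumFin (suc n) (λ j → sumFin (suc n) (λ i → T i j))
      ≈⟨ sumFin-cong (suc n) (λ j → trans (*-congˡ (*-congˡ (sym (det-firstColumnExpansion n (minor M (fsuc j))))))
           (trans (scaleSum (- sign (toℕ j)) (M fzero (fsuc j)) (λ i → sign (toℕ i) * (M (fsuc i) fzero * det n (D i j))))
             (sumFin-cong (suc n) (λ i →
               columnFirst (sign (toℕ i)) (sign (toℕ j)) (M (fsuc i) fzero) (M fzero (fsuc j)) (det n (D i j)))))) ⟨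
    sumFin (suc n) (λ j → - sign (toℕ j) * (M fzero (fsuc j) * det (suc n) (minor M (fsuc j)))) ∎)
    where
    D : Fin (suc n) → Fin (suc n) → Matrix n
    D i j a b = M (fsuc (punchIn i a)) (fsuc (punchIn j b))
    T : Fin (suc n) → Fin (suc n) → Carrier
    T i j = - (sign (toℕ i) * sign (toℕ j) * (M (fsuc i) fzero * M fzero (fsuc j)) * det n (D i j))
    scaleSum : ∀ x y (g : Fin (suc n) → Carrier) →
      x * (y * sumFin (suc n) g) ≈ sumFin (suc n) (λ j → x * (y * g j))
    scaleSum x y g = trans (*-congˡ (*-distribˡ-sumFin (suc n) y g)) (*-distribˡ-sumFin (suc n) x (λ j → y * g j))
    rowFirst : ∀ sᵢ sⱼ a b d → - sᵢ * (a * (sⱼ * (b * d))) ≈ - (sᵢ * sⱼ * (a * b) * d)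
    rowFirst = solve 5 (λ si sj a b d → (:- si) :* (a :* (sj :* (b :* d))) := :- (si :* sj :* (a :* b) :* d)) refl
    columnFirst : ∀ sᵢ sⱼ a b d → - sⱼ * (b * (sᵢ * (a * d))) ≈ - (sᵢ * sⱼ * (a * b) * d)
    columnFirst = solve 5 (λ si sj a b d → (:- sj) :* (b :* (si :* (a :* d))) := :- (si :* sj :* (a :* b) :* d)) refl

  det-lowerTriangular : ∀ n (M : Matrix n) → (∀ i j → toℕ i ℕ.< toℕ j → M i j ≈ 0#) →
    det n M ≈ prodFin n (λ i → M i i)
  det-lowerTriangular zero    M _     = refl
  det-lowerTriangular (suc n) M lower = begin
    1# * (M fzero fzero * det n (minor M fzero)) + sumFin n (λ j → expansionTerm M (fsuc j))
      ≈⟨ +-cong (*-identityˡ _) (sumFin-zero n λ j →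
           trans (*-congˡ (*-congʳ (lower fzero (fsuc j) (s≤s z≤n)))) (trans (*-congˡ (zeroˡ _)) (zeroʳ _))) ⟩
    M fzero fzero * det n (minor M fzero) + 0#
      ≈⟨ +-identityʳ _ ⟩
    M fzero fzero * det n (minor M fzero)
      ≈⟨ *-congˡ (det-lowerTriangular n (minor M fzero) (λ i j i<j → lower (fsuc i) (fsuc j) (s≤s i<j))) ⟩
    M fzero fzero * prodFin n (λ i → M (fsuc i) (fsuc i)) ∎

  det-upperTriangular : ∀ n (M : Matrix n) → (∀ i j → toℕ j ℕ.< toℕ i → M i j ≈ 0#) →
    det n M ≈ prodFin n (λ i → M i i)
  det-upperTriangular zero    M _     = refl
  det-upperTriangular (suc n) M upper = begin
    det (suc n) M
      ≈⟨ det-firstColumnExpansion n M ⟨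
    1# * (M fzero fzero * det n M′) + sumFin n (λ i → - sign (toℕ i) *
      (M (fsuc i) fzero * det n (λ a b → M (punchIn (fsuc i) a) (fsuc b))))
      ≈⟨ +-cong (*-identityˡ _) (sumFin-zero n λ i →
           trans (*-congˡ (*-congʳ (upper (fsuc i) fzero (s≤s z≤n)))) (trans (*-congˡ (zeroˡ _)) (zeroʳ _))) ⟩
    M fzero fzero * det n M′ + 0#
      ≈⟨ +-identityʳ _ ⟩
    M fzero fzero * det n M′
      ≈⟨ *-congˡ (det-upperTriangular n M′ (λ i j j<i → upper (fsuc i) (fsuc j) (s≤s j<i))) ⟩
    M fzero fzero * prodFin n (λ i → M (fsuc i) (fsuc i)) ∎
    where
    M′ : Matrix n
    M′ a b = M (fsuc a) (fsuc b)

  -- Multiplicativity of the determinant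

  record AlternatingForm (n : ℕ) (G : Matrix n → Carrier) : Set (c ⊔ ℓ) where
    field
      cong : ∀ (A B : Matrix n) → (∀ i j → A i j ≈ B i j) → G A ≈ G B
      linear : ∀ (A B C : Matrix n) (r : Fin n) x →
        (∀ i j → j ≢ r → A i j ≈ B i j) → (∀ i j → j ≢ r → A i j ≈ C i j) →
        (∀ i → A i r ≈ B i r + x * C i r) → G A ≈ G B + x * G C
      equalColumns : ∀ (A : Matrix n) (p q : Fin n) → toℕ p ℕ.< toℕ q →
        (∀ i → A i p ≈ A i q) → G A ≈ 0#

  replaceColumn : ∀ {n} → Fin n → (Fin n → Carrier) → Matrix n → Matrix n
  replaceColumn r v M i j with j Fin.≟ r
  ... | yes _ = v i
  ... | no _  = M i j

  replaceColumn-same : ∀ {n} r v (M : Matrix n) i → replaceColumn r v M i r ≈ v i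
  replaceColumn-same r v M i with r Fin.≟ r
  ... | yes _  = refl
  ... | no r≢r = ⊥-elim (r≢r ≡.refl)

  replaceColumn-other : ∀ {n} r v (M : Matrix n) i j → j ≢ r → replaceColumn r v M i j ≈ M i j
  replaceColumn-other r v M i j j≢r with j Fin.≟ r
  ... | yes j≡r = ⊥-elim (j≢r j≡r)
  ... | no _    = refl

  linear-replaceColumn : ∀ {n} {G : Matrix n → Carrier} → AlternatingForm n G →
    ∀ A B r x v → (∀ i j → j ≢ r → A i j ≈ B i j) → (∀ i → A i r ≈ B i r + x * v i) →
    G A ≈ G B + x * G (replaceColumn r v B)
  linear-replaceColumn alt A B r x v A≈B Aᵣ = AlternatingForm.linear alt A B (replaceColumn r v B) r x A≈B
    (λ i j j≢r → trans (A≈B i j j≢r) (sym (replaceColumn-other r v B i j j≢r)))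
    (λ i → trans (Aᵣ i) (+-congˡ (*-congˡ (sym (replaceColumn-same r v B i)))))

  det-alternatingForm : ∀ n → AlternatingForm n (det n)
  det-alternatingForm n = record
    { cong = λ A B → det-cong n ; linear = det-linear n ; equalColumns = det-equalColumns n }

  1ᴹ : ∀ {n} → Matrix n
  1ᴹ fzero    fzero    = 1#
  1ᴹ fzero    (fsuc _) = 0#
  1ᴹ (fsuc _) fzero    = 0#
  1ᴹ (fsuc a) (fsuc b) = 1ᴹ a b

  1ᴹ-fromℕ : ∀ {n} (i : Fin (suc n)) → toℕ i ≡ n → 1ᴹ i (fromℕ n) ≡ 1#
  1ᴹ-fromℕ {zero}  fzero    _       = ≡.refl
  1ᴹ-fromℕ {suc n} (fsuc i) 1+i≡1+n = 1ᴹ-fromℕ i (ℕ.suc-injective 1+i≡1+n)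

  1ᴹ-fromℕ-≢ : ∀ {n} (i : Fin (suc n)) → toℕ i ≢ n → 1ᴹ i (fromℕ n) ≡ 0#
  1ᴹ-fromℕ-≢ {zero}  fzero    0≢0     = ⊥-elim (0≢0 ≡.refl)
  1ᴹ-fromℕ-≢ {suc n} fzero    _       = ≡.refl
  1ᴹ-fromℕ-≢ {suc n} (fsuc i) 1+i≢1+n = 1ᴹ-fromℕ-≢ i (λ e → 1+i≢1+n (≡.cong suc e))

  sumFin-1ᴹʳ : ∀ n (g : Fin n → Carrier) a → sumFin n (λ i → g i * 1ᴹ a i) ≈ g a
  sumFin-1ᴹʳ (suc n) g fzero    = trans (+-cong (*-identityʳ _) (sumFin-zero n (λ i → zeroʳ _))) (+-identityʳ _)
  sumFin-1ᴹʳ (suc n) g (fsuc a) = trans (+-cong (zeroʳ _) (sumFin-1ᴹʳ n (λ i → g (fsuc i)) a)) (+-identityˡ _)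

  sumFin-1ᴹˡ : ∀ n (g : Fin n → Carrier) a → sumFin n (λ i → g i * 1ᴹ i a) ≈ g a
  sumFin-1ᴹˡ (suc n) g fzero    = trans (+-cong (*-identityʳ _) (sumFin-zero n (λ i → zeroʳ _))) (+-identityʳ _)
  sumFin-1ᴹˡ (suc n) g (fsuc a) = trans (+-cong (zeroʳ _) (sumFin-1ᴹˡ n (λ i → g (fsuc i)) a)) (+-identityˡ _)

  withFirstColumn : ∀ {n} → (Fin (suc n) → Carrier) → Matrix (suc n) → Matrix (suc n)
  withFirstColumn v Y a fzero    = v a
  withFirstColumn v Y a (fsuc b) = Y a (fsuc b)

  module AlternatingFormProperties {n : ℕ} {G : Matrix (suc n) → Carrier}
                                   (alt : AlternatingForm (suc n) G) where
    open AlternatingForm alt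

    zeroFirstColumn : ∀ Y → G (withFirstColumn (λ _ → 0#) Y) ≈ 0#
    zeroFirstColumn Y = x+x≈x⇒x≈0 (G Z) (sym (trans doubled (+-congˡ (*-identityˡ (G Z)))))
      where
      open import Algebra.Properties.Ring ring using (x+x≈x⇒x≈0)
      Z = withFirstColumn (λ _ → 0#) Y
      doubled : G Z ≈ G Z + 1# * G Z
      doubled = linear Z Z Z fzero 1# (λ _ _ _ → refl) (λ _ _ _ → refl)
                  (λ _ → sym (trans (+-congˡ (zeroʳ 1#)) (+-identityʳ 0#)))

    linearFirstColumn : ∀ k (a : Fin k → Carrier) (v : Fin k → Fin (suc n) → Carrier) Y →
      G (withFirstColumn (λ r → sumFin k (λ i → a i * v i r)) Y) ≈
      sumFin k (λ i → a i * G (withFirstColumn (v i) Y))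
    linearFirstColumn zero    a v Y = zeroFirstColumn Y
    linearFirstColumn (suc k) a v Y = begin
      G (withFirstColumn (λ r → a fzero * v fzero r + rest r) Y)
        ≈⟨ linear _ (withFirstColumn rest Y) (withFirstColumn (v fzero) Y) fzero (a fzero)
                  sameRest sameRest (λ _ → +-comm _ _) ⟩
      G (withFirstColumn rest Y) + a fzero * G (withFirstColumn (v fzero) Y)
        ≈⟨ +-congʳ (linearFirstColumn k (λ i → a (fsuc i)) (λ i → v (fsuc i)) Y) ⟩
      sumFin k (λ i → a (fsuc i) * G (withFirstColumn (v (fsuc i)) Y))
        + a fzero * G (withFirstColumn (v fzero) Y)
        ≈⟨ +-comm _ _ ⟩
      sumFin (suc k) (λ i → a i * G (withFirstColumn (v i) Y)) ∎
      where
      rest : Fin (suc n) → Carrier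
      rest r = sumFin k (λ i → a (fsuc i) * v (fsuc i) r)
      sameRest : ∀ {u w} i j → j ≢ fzero → withFirstColumn u Y i j ≈ withFirstColumn w Y i j
      sameRest i fzero    0≢0 = ⊥-elim (0≢0 ≡.refl)
      sameRest i (fsuc j) _   = refl

    -- Column b of B is put in place for b < m, column b of A for b ≥ m; each step
    -- changes one column by a multiple of column 0, which costs G nothing.
    module AddFirstColumn (A B : Matrix (suc n)) (coeff : Fin n → Carrier)
      (sameFirst : ∀ i → A i fzero ≈ B i fzero)
      (shifted : ∀ i b → A i (fsuc b) ≈ B i (fsuc b) + coeff b * B i fzero) where

      partial : ℕ → Matrix (suc n)
      partial m i fzero = B i fzero
      partial m i (fsuc b) with toℕ b ℕ.<? m
      ... | yes _ = B i (fsuc b)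
      ... | no _  = A i (fsuc b)

      partial-zero : ∀ i j → A i j ≈ partial 0 i j
      partial-zero i fzero    = sameFirst i
      partial-zero i (fsuc b) = refl

      partial-all : ∀ i j → partial n i j ≈ B i j
      partial-all i fzero    = refl
      partial-all i (fsuc b) with toℕ b ℕ.<? n
      ... | yes _  = refl
      ... | no b≮n = ⊥-elim (b≮n (toℕ<n b))

      partial-step : ∀ m → m ℕ.< n → G (partial m) ≈ G (partial (suc m))
      partial-step m m<n = begin
        G (partial m)
          ≈⟨ linear-replaceColumn alt (partial m) (partial (suc m)) r (coeff b) (λ i → B i fzero) unchanged changed ⟩
        G (partial (suc m)) + coeff b * G (replaceColumn r (λ i → B i fzero) (partial (suc m)))
          ≈⟨ +-congˡ (trans (*-congˡ twoEqualColumns) (zeroʳ _)) ⟩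
        G (partial (suc m)) + 0#
          ≈⟨ +-identityʳ _ ⟩
        G (partial (suc m)) ∎
        where
        b = fromℕ< m<n
        r = fsuc b
        twoEqualColumns : G (replaceColumn r (λ i → B i fzero) (partial (suc m))) ≈ 0#
        twoEqualColumns = equalColumns _ fzero r (s≤s z≤n)
          (λ i → sym (replaceColumn-same r (λ i → B i fzero) (partial (suc m)) i))
        unchanged : ∀ i j → j ≢ r → partial m i j ≈ partial (suc m) i j
        unchanged i fzero    _ = refl
        unchanged i (fsuc a) a≢b with toℕ a ℕ.<? m | toℕ a ℕ.<? suc m
        ... | yes _   | yes _    = refl
        ... | no _    | no _     = refl
        ... | yes a<m | no a≮m+1 = ⊥-elim (a≮m+1 (ℕ.m<n⇒m<1+n a<m))
        ... | no a≮m  | yes a<m+1 = ⊥-elim (a≢b (≡.cong fsuc (toℕ-injective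
                (≡.trans (ℕ.≤-antisym (ℕ.≤-pred a<m+1) (ℕ.≮⇒≥ a≮m)) (≡.sym (toℕ-fromℕ< m<n))))))
        before : ∀ i → partial m i r ≈ A i r
        before i with toℕ b ℕ.<? m
        ... | yes b<m = ⊥-elim (ℕ.<-irrefl (toℕ-fromℕ< m<n) b<m)
        ... | no _    = refl
        after : ∀ i → partial (suc m) i r ≈ B i r
        after i with toℕ b ℕ.<? suc m
        ... | yes _      = refl
        ... | no b≮m+1 = ⊥-elim (b≮m+1 (≡.subst (ℕ._< suc m) (≡.sym (toℕ-fromℕ< m<n)) ℕ.≤-refl))
        changed : ∀ i → partial m i r ≈ partial (suc m) i r + coeff b * B i fzero
        changed i = trans (before i) (trans (shifted i b) (+-congʳ (sym (after i))))

      partial-upTo : ∀ m → m ℕ.≤ n → G A ≈ G (partial m)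
      partial-upTo zero    _     = cong A (partial 0) partial-zero
      partial-upTo (suc m) m<n   = trans (partial-upTo m (ℕ.<⇒≤ m<n)) (partial-step m m<n)

      invariant : G A ≈ G B
      invariant = trans (partial-upTo n ℕ.≤-refl) (cong (partial n) B partial-all)

  withFirstTwoColumns : ∀ {n} (x y : Fin (suc (suc n)) → Carrier) → Matrix (suc (suc n)) → Matrix (suc (suc n))
  withFirstTwoColumns x y A a fzero           = x a
  withFirstTwoColumns x y A a (fsuc fzero)    = y a
  withFirstTwoColumns x y A a (fsuc (fsuc b)) = A a (fsuc (fsuc b))

  swapFirstTwoColumns : ∀ {n} → Matrix (suc (suc n)) → Matrix (suc (suc n))
  swapFirstTwoColumns A = withFirstTwoColumns (λ a → A a (fsuc fzero)) (λ a → A a fzero) A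

  alternatingForm-swapFirstTwoColumns : ∀ {n} {G : Matrix (suc (suc n)) → Carrier} →
    AlternatingForm (suc (suc n)) G → ∀ A → G A ≈ - G (swapFirstTwoColumns A)
  alternatingForm-swapFirstTwoColumns {n} {G} alt A =
    trans (cong A (W u v) unfold) (inverseʳ-unique (G (W v u)) (G (W u v)) cancels)
    where
    open AlternatingForm alt
    W = λ x y → withFirstTwoColumns x y A
    u v : Fin (suc (suc n)) → Carrier
    u a = A a fzero
    v a = A a (fsuc fzero)
    unfold : ∀ i j → A i j ≈ W u v i j
    unfold i fzero           = refl
    unfold i (fsuc fzero)    = refl
    unfold i (fsuc (fsuc b)) = refl
    linear₀ : ∀ x y w → G (W (λ a → x a + y a) w) ≈ G (W x w) + 1# * G (W y w)
    linear₀ x y w = linear _ _ _ fzero 1# off off (λ i → +-congˡ (sym (*-identityˡ _)))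
      where
      off : ∀ {x′ y′} i j → j ≢ fzero → W x′ w i j ≈ W y′ w i j
      off i fzero           0≢0 = ⊥-elim (0≢0 ≡.refl)
      off i (fsuc fzero)    _   = refl
      off i (fsuc (fsuc b)) _   = refl
    linear₁ : ∀ x y w → G (W w (λ a → x a + y a)) ≈ G (W w x) + 1# * G (W w y)
    linear₁ x y w = linear _ _ _ (fsuc fzero) 1# off off (λ i → +-congˡ (sym (*-identityˡ _)))
      where
      off : ∀ {x′ y′} i j → j ≢ fsuc fzero → W w x′ i j ≈ W w y′ i j
      off i fzero           _   = refl
      off i (fsuc fzero)    1≢1 = ⊥-elim (1≢1 ≡.refl)
      off i (fsuc (fsuc b)) _   = refl
    equal : ∀ x → G (W x x) ≈ 0#
    equal x = equalColumns _ fzero (fsuc fzero) (s≤s z≤n) (λ i → refl)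
    s : Fin (suc (suc n)) → Carrier
    s a = u a + v a
    cancels : G (W v u) + G (W u v) ≈ 0#
    cancels = sym (begin
      0#                                        ≈⟨ equal s ⟨
      G (W s s)                                 ≈⟨ linear₀ u v s ⟩
      G (W u s) + 1# * G (W v s)                ≈⟨ +-cong (linear₁ u v u) (*-congˡ (linear₁ u v v)) ⟩
      (G (W u u) + 1# * G (W u v)) + 1# * (G (W v u) + 1# * G (W v v))
        ≈⟨ +-cong (+-congʳ (equal u)) (*-congˡ (+-congˡ (*-congˡ (equal v)))) ⟩
      (0# + 1# * G (W u v)) + 1# * (G (W v u) + 1# * 0#)
        ≈⟨ solve 2 (λ a b → (con 0ℤ :+ con 1ℤ :* a) :+ con 1ℤ :* (b :+ con 1ℤ :* con 0ℤ) := b :+ a) refl _ _ ⟩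
      G (W v u) + G (W u v)                     ∎)

  insertZero : ∀ {n} → Fin (suc n) → (Fin n → Carrier) → Fin (suc n) → Carrier
  insertZero fzero            z fzero    = 0#
  insertZero fzero            z (fsuc a) = z a
  insertZero {suc n} (fsuc i) z fzero    = z fzero
  insertZero {suc n} (fsuc i) z (fsuc a) = insertZero i (λ r → z (fsuc r)) a

  insertZero-split : ∀ {n} (i : Fin (suc n)) (z : Fin (suc n) → Carrier) a →
    z a ≈ insertZero i (λ r → z (punchIn i r)) a + z i * 1ᴹ a i
  insertZero-split fzero            z fzero    = sym (trans (+-identityˡ _) (*-identityʳ _))
  insertZero-split fzero            z (fsuc a) = sym (trans (+-congˡ (zeroʳ _)) (+-identityʳ _))
  insertZero-split {suc n} (fsuc i) z fzero    = sym (trans (+-congˡ (zeroʳ _)) (+-identityʳ _))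
  insertZero-split {suc n} (fsuc i) z (fsuc a) = insertZero-split i (λ r → z (fsuc r)) a

  insertZero-cong : ∀ {n} (i : Fin (suc n)) {u v : Fin n → Carrier} → (∀ r → u r ≈ v r) →
    ∀ a → insertZero i u a ≈ insertZero i v a
  insertZero-cong fzero            e fzero    = refl
  insertZero-cong fzero            e (fsuc a) = e a
  insertZero-cong {suc n} (fsuc i) e fzero    = e fzero
  insertZero-cong {suc n} (fsuc i) e (fsuc a) = insertZero-cong i (λ r → e (fsuc r)) a

  insertZero-linear : ∀ {n} (i : Fin (suc n)) (u v : Fin n → Carrier) x a →
    insertZero i (λ r → u r + x * v r) a ≈ insertZero i u a + x * insertZero i v a
  insertZero-linear fzero            u v x fzero    = sym (trans (+-identityˡ _) (zeroʳ x))
  insertZero-linear fzero            u v x (fsuc a) = refl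
  insertZero-linear {suc n} (fsuc i) u v x fzero    = refl
  insertZero-linear {suc n} (fsuc i) u v x (fsuc a) =
    insertZero-linear i (λ r → u (fsuc r)) (λ r → v (fsuc r)) x a

  insertZero-zero : ∀ {n} (i : Fin (suc n)) a → insertZero {n} i (λ _ → 0#) a ≈ 0#
  insertZero-zero fzero            fzero    = refl
  insertZero-zero fzero            (fsuc a) = refl
  insertZero-zero {suc n} (fsuc i) fzero    = refl
  insertZero-zero {suc n} (fsuc i) (fsuc a) = insertZero-zero i a

  unitColumnAt : ∀ {n} → Fin (suc n) → Matrix n → Matrix (suc n)
  unitColumnAt i Z a fzero    = 1ᴹ a i
  unitColumnAt i Z a (fsuc b) = insertZero i (λ r → Z r b) a

  1⊕_ : ∀ {n} → Matrix n → Matrix (suc n)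
  (1⊕ Z) fzero    fzero    = 1#
  (1⊕ Z) fzero    (fsuc b) = 0#
  (1⊕ Z) (fsuc a) fzero    = 0#
  (1⊕ Z) (fsuc a) (fsuc b) = Z a b

  alternatingForm-unitColumnAt : ∀ {n} {G : Matrix (suc n) → Carrier} → AlternatingForm (suc n) G →
    (i : Fin (suc n)) → AlternatingForm n (λ Z → G (unitColumnAt i Z))
  alternatingForm-unitColumnAt {n} {G} alt i = record
    { cong = λ A B A≈B → cong _ _ λ
        { a fzero → refl ; a (fsuc b) → insertZero-cong i (λ r → A≈B r b) a }
    ; linear = λ A B C r x A≈B A≈C Aᵣ → linear _ _ _ (fsuc r) x
        (λ { a fzero _ → refl ; a (fsuc b) b≢r → insertZero-cong i (λ q → A≈B q b (λ e → b≢r (≡.cong fsuc e))) a })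
        (λ { a fzero _ → refl ; a (fsuc b) b≢r → insertZero-cong i (λ q → A≈C q b (λ e → b≢r (≡.cong fsuc e))) a })
        (λ a → trans (insertZero-cong i Aᵣ a) (insertZero-linear i _ _ x a))
    ; equalColumns = λ A p q p<q Aₚ≈A_q →
        equalColumns _ (fsuc p) (fsuc q) (s≤s p<q) (insertZero-cong i Aₚ≈A_q)
    }
    where open AlternatingForm alt

  alternatingForm-1⊕ : ∀ {n} {G : Matrix (suc n) → Carrier} → AlternatingForm (suc n) G →
    AlternatingForm n (λ Z → G (1⊕ Z))
  alternatingForm-1⊕ {n} {G} alt = record
    { cong = λ A B A≈B → cong _ _ λ
        { fzero fzero → refl ; fzero (fsuc b) → refl ; (fsuc a) fzero → refl ; (fsuc a) (fsuc b) → A≈B a b }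
    ; linear = λ A B C r x A≈B A≈C Aᵣ → linear _ _ _ (fsuc r) x
        (λ { fzero fzero _ → refl ; fzero (fsuc b) _ → refl ; (fsuc a) fzero _ → refl
           ; (fsuc a) (fsuc b) b≢r → A≈B a b (λ e → b≢r (≡.cong fsuc e)) })
        (λ { fzero fzero _ → refl ; fzero (fsuc b) _ → refl ; (fsuc a) fzero _ → refl
           ; (fsuc a) (fsuc b) b≢r → A≈C a b (λ e → b≢r (≡.cong fsuc e)) })
        (λ { fzero → sym (trans (+-identityˡ _) (zeroʳ x)) ; (fsuc a) → Aᵣ a })
    ; equalColumns = λ A p q p<q Aₚ≈A_q →
        equalColumns _ (fsuc p) (fsuc q) (s≤s p<q) (λ { fzero → refl ; (fsuc a) → Aₚ≈A_q a })
    }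
    where open AlternatingForm alt

  -- unitColumnAt i 1ᴹ is 1ᴹ with column 0 moved to position i, i.e. i adjacent swaps
  alternatingForm-unitColumnAt-1ᴹ : ∀ n (G : Matrix (suc n) → Carrier) → AlternatingForm (suc n) G →
    ∀ i → G (unitColumnAt i 1ᴹ) ≈ sign (toℕ i) * G 1ᴹ
  alternatingForm-unitColumnAt-1ᴹ n G alt fzero = trans (cong _ _ same) (sym (*-identityˡ _))
    where
    open AlternatingForm alt
    same : ∀ a b → unitColumnAt fzero 1ᴹ a b ≈ 1ᴹ a b
    same a        fzero    = refl
    same fzero    (fsuc b) = refl
    same (fsuc a) (fsuc b) = refl
  alternatingForm-unitColumnAt-1ᴹ (suc n) G alt (fsuc i) = begin
    G (unitColumnAt (fsuc i) 1ᴹ)                ≈⟨ alternatingForm-swapFirstTwoColumns alt _ ⟩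
    - G (swapFirstTwoColumns (unitColumnAt (fsuc i) 1ᴹ))
                                                ≈⟨ -‿cong (cong _ _ swapped) ⟩
    - G (1⊕ unitColumnAt i 1ᴹ)
      ≈⟨ -‿cong (alternatingForm-unitColumnAt-1ᴹ n _ (alternatingForm-1⊕ alt) i) ⟩
    - (sign (toℕ i) * G (1⊕ 1ᴹ))                ≈⟨ -‿cong (*-congˡ (cong _ _ 1⊕1ᴹ)) ⟩
    - (sign (toℕ i) * G 1ᴹ)                     ≈⟨ -‿distribˡ-* _ _ ⟩
    - sign (toℕ i) * G 1ᴹ                       ∎
    where
    open AlternatingForm alt
    swapped : ∀ a b → swapFirstTwoColumns (unitColumnAt (fsuc i) 1ᴹ) a b ≈ (1⊕ unitColumnAt i 1ᴹ) a b
    swapped fzero    fzero           = refl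
    swapped (fsuc a) fzero           = insertZero-zero i a
    swapped fzero    (fsuc fzero)    = refl
    swapped (fsuc a) (fsuc fzero)    = refl
    swapped fzero    (fsuc (fsuc b)) = refl
    swapped (fsuc a) (fsuc (fsuc b)) = refl
    1⊕1ᴹ : ∀ a b → (1⊕ 1ᴹ) a b ≈ 1ᴹ a b
    1⊕1ᴹ fzero    fzero    = refl
    1⊕1ᴹ fzero    (fsuc b) = refl
    1⊕1ᴹ (fsuc a) fzero    = refl
    1⊕1ᴹ (fsuc a) (fsuc b) = refl

  -- Expand column 0 of Y in the unit vectors; clearing row i of the other columns against
  -- e_i leaves unitColumnAt i applied to the minor Zᵢ, which is handled by induction.
  alternatingForm-det : ∀ n (G : Matrix n → Carrier) → AlternatingForm n G →
    ∀ Y → G Y ≈ det n Y * G 1ᴹ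
  alternatingForm-det zero    G alt Y = trans (AlternatingForm.cong alt Y 1ᴹ (λ ())) (sym (*-identityˡ _))
  alternatingForm-det (suc n) G alt Y = begin
    G Y
      ≈⟨ cong _ _ firstColumnInUnits ⟩
    G (withFirstColumn (λ a → sumFin (suc n) (λ i → Y i fzero * 1ᴹ a i)) Y)
      ≈⟨ linearFirstColumn (suc n) (λ i → Y i fzero) (λ i a → 1ᴹ a i) Y ⟩
    sumFin (suc n) (λ i → Y i fzero * G (withFirstColumn (λ a → 1ᴹ a i) Y))
      ≈⟨ sumFin-cong (suc n) term ⟩
    sumFin (suc n) (λ i → G 1ᴹ * (sign (toℕ i) * (Y i fzero * det n (Z i))))
      ≈⟨ *-distribˡ-sumFin (suc n) (G 1ᴹ) (λ i → sign (toℕ i) * (Y i fzero * det n (Z i))) ⟨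
    G 1ᴹ * firstColumnExpansion n Y
      ≈⟨ *-comm _ _ ⟩
    firstColumnExpansion n Y * G 1ᴹ
      ≈⟨ *-congʳ (det-firstColumnExpansion n Y) ⟩
    det (suc n) Y * G 1ᴹ ∎
    where
    open AlternatingForm alt
    open AlternatingFormProperties alt
    Z : Fin (suc n) → Matrix n
    Z i a b = Y (punchIn i a) (fsuc b)
    firstColumnInUnits : ∀ a b → Y a b ≈ withFirstColumn (λ a → sumFin (suc n) (λ i → Y i fzero * 1ᴹ a i)) Y a b
    firstColumnInUnits a fzero    = sym (sumFin-1ᴹʳ (suc n) (λ i → Y i fzero) a)
    firstColumnInUnits a (fsuc b) = refl
    term : ∀ i → Y i fzero * G (withFirstColumn (λ a → 1ᴹ a i) Y) ≈
                 G 1ᴹ * (sign (toℕ i) * (Y i fzero * det n (Z i)))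
    term i = begin
      Y i fzero * G (withFirstColumn (λ a → 1ᴹ a i) Y)
        ≈⟨ *-congˡ (AddFirstColumn.invariant (withFirstColumn (λ a → 1ᴹ a i) Y) (unitColumnAt i (Z i))
             (λ b → Y i (fsuc b)) (λ a → refl) (λ a b → insertZero-split i (λ a → Y a (fsuc b)) a)) ⟩
      Y i fzero * G (unitColumnAt i (Z i))
        ≈⟨ *-congˡ (alternatingForm-det n _ (alternatingForm-unitColumnAt alt i) (Z i)) ⟩
      Y i fzero * (det n (Z i) * G (unitColumnAt i 1ᴹ))
        ≈⟨ *-congˡ (*-congˡ (alternatingForm-unitColumnAt-1ᴹ n G alt i)) ⟩
      Y i fzero * (det n (Z i) * (sign (toℕ i) * G 1ᴹ))
        ≈⟨ solve 4 (λ y d s g → y :* (d :* (s :* g)) := g :* (s :* (y :* d))) refl _ _ _ _ ⟩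
      G 1ᴹ * (sign (toℕ i) * (Y i fzero * det n (Z i))) ∎

  infixl 7 _*ᴹ_
  _*ᴹ_ : ∀ {n} → Matrix n → Matrix n → Matrix n
  _*ᴹ_ {n} X Y i j = sumFin n (λ k → X i k * Y k j)

  alternatingForm-det-*ᴹ : ∀ n (X : Matrix n) → AlternatingForm n (λ Y → det n (X *ᴹ Y))
  alternatingForm-det-*ᴹ n X = record
    { cong = λ A B A≈B → det-cong n (λ i j → sumFin-cong n (λ k → *-congˡ (A≈B k j)))
    ; linear = λ A B C r x A≈B A≈C Aᵣ → det-linear n (X *ᴹ A) (X *ᴹ B) (X *ᴹ C) r x
        (λ i j j≢r → sumFin-cong n (λ k → *-congˡ (A≈B k j j≢r)))
        (λ i j j≢r → sumFin-cong n (λ k → *-congˡ (A≈C k j j≢r)))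
        (λ i → trans (sumFin-cong n (λ k → trans (*-congˡ (Aᵣ k))
                 (solve 4 (λ a b x c → a :* (b :+ x :* c) := a :* b :+ x :* (a :* c)) refl (X i k) (B k r) x (C k r))))
               (trans (sumFin-+ n (λ k → X i k * B k r) (λ k → x * (X i k * C k r)))
                 (+-congˡ (sym (*-distribˡ-sumFin n x (λ k → X i k * C k r))))))
    ; equalColumns = λ A p q p<q Aₚ≈A_q →
        det-equalColumns n (X *ᴹ A) p q p<q (λ i → sumFin-cong n (λ k → *-congˡ (Aₚ≈A_q k)))
    }

  det-*ᴹ : ∀ n (X Y : Matrix n) → det n (X *ᴹ Y) ≈ det n Y * det n X
  det-*ᴹ n X Y = trans (alternatingForm-det n _ (alternatingForm-det-*ᴹ n X) Y)
                       (*-congˡ (det-cong n (λ i j → sumFin-1ᴹˡ n (X i) j)))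

  punchIn-inject₁-fromℕ : ∀ {n} (j : Fin (suc n)) → punchIn (inject₁ j) (fromℕ n) ≡ fromℕ (suc n)
  punchIn-inject₁-fromℕ         fzero    = ≡.refl
  punchIn-inject₁-fromℕ {suc n} (fsuc j) = ≡.cong fsuc (punchIn-inject₁-fromℕ j)

  punchIn-inject₁-inject₁ : ∀ {n} (j : Fin (suc n)) (b : Fin n) →
    punchIn (inject₁ j) (inject₁ b) ≡ inject₁ (punchIn j b)
  punchIn-inject₁-inject₁         fzero    b        = ≡.refl
  punchIn-inject₁-inject₁ {suc n} (fsuc j) fzero    = ≡.refl
  punchIn-inject₁-inject₁ {suc n} (fsuc j) (fsuc b) = ≡.cong fsuc (punchIn-inject₁-inject₁ j b)

  det-lastColumnUnit : ∀ n (M : Matrix (suc n)) → (∀ i → M i (fromℕ n) ≈ 1ᴹ i (fromℕ n)) →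
    det (suc n) M ≈ det n (λ i j → M (inject₁ i) (inject₁ j))
  det-lastColumnUnit zero    M unit = trans (+-identityʳ _) (trans (*-identityˡ _) (trans (*-identityʳ _) (unit fzero)))
  det-lastColumnUnit (suc n) M unit = begin
    det (suc (suc n)) M
      ≈⟨ sumFin-last (suc n) (expansionTerm M) ⟩
    sumFin (suc n) (λ j → expansionTerm M (inject₁ j)) + expansionTerm M (fromℕ (suc n))
      ≈⟨ +-cong (sumFin-cong (suc n) term) lastTerm ⟩
    det (suc n) (λ i j → M (inject₁ i) (inject₁ j)) + 0#
      ≈⟨ +-identityʳ _ ⟩
    det (suc n) (λ i j → M (inject₁ i) (inject₁ j)) ∎
    where
    lastTerm : expansionTerm M (fromℕ (suc n)) ≈ 0#
    lastTerm = trans (*-congˡ (*-congʳ (unit fzero))) (trans (*-congˡ (zeroˡ _)) (zeroʳ _))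
    term : ∀ j → expansionTerm M (inject₁ j) ≈ expansionTerm (λ i j → M (inject₁ i) (inject₁ j)) j
    term j = *-cong (sign-inject₁ j) (*-congˡ (trans
      (det-lastColumnUnit n (minor M (inject₁ j))
        (λ a → trans (reflexive (≡.cong (M (fsuc a)) (punchIn-inject₁-fromℕ j))) (unit (fsuc a))))
      (det-cong n (λ a b → reflexive (≡.cong (M (fsuc (inject₁ a))) (punchIn-inject₁-inject₁ j b))))))

  toMatrix : ∀ n → (ℕ → ℕ → Carrier) → Matrix n
  toMatrix n G a b = G (toℕ a) (toℕ b)

  shift : ℕ → (ℕ → ℕ → Carrier) → ℕ → ℕ → Carrier
  shift d G p l = G (d +ℕ p) (d +ℕ l)

  det-tridiagonal : ∀ n (G : ℕ → ℕ → Carrier) →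
    (∀ l → G 0 (suc (suc l)) ≈ 0#) → (∀ p → G (suc (suc p)) 0 ≈ 0#) →
    det (suc (suc n)) (toMatrix (suc (suc n)) G) ≈
      G 0 0 * det (suc n) (toMatrix (suc n) (shift 1 G)) - G 0 1 * G 1 0 * det n (toMatrix n (shift 2 G))
  det-tridiagonal n G row₀ column₀ = begin
    1# * (G 0 0 * D₁) + (- 1# * (G 0 1 * det (suc n) M₁) + sumFin n (λ j → expansionTerm (toMatrix _ G) (fsuc (fsuc j))))
      ≈⟨ +-congˡ (+-cong (*-congˡ (*-congˡ minor₁)) (sumFin-zero n λ j →
           trans (*-congˡ (*-congʳ (row₀ (toℕ j)))) (trans (*-congˡ (zeroˡ _)) (zeroʳ _)))) ⟩
    1# * (G 0 0 * D₁) + (- 1# * (G 0 1 * (G 1 0 * D₂)) + 0#)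
      ≈⟨ solve 5 (λ a d₁ b c d₂ → con 1ℤ :* (a :* d₁) :+ ((:- con 1ℤ) :* (b :* (c :* d₂)) :+ con 0ℤ)
                                  := a :* d₁ :- b :* c :* d₂) refl _ _ _ _ _ ⟩
    G 0 0 * D₁ - G 0 1 * G 1 0 * D₂ ∎
    where
    D₁ = det (suc n) (toMatrix (suc n) (shift 1 G))
    D₂ = det n (toMatrix n (shift 2 G))
    M₁ : Matrix (suc n)
    M₁ = minor (toMatrix (suc (suc n)) G) (fsuc fzero)
    minor₁ : det (suc n) M₁ ≈ G 1 0 * D₂
    minor₁ = begin
      det (suc n) M₁
        ≈⟨ det-firstColumnExpansion n M₁ ⟨
      1# * (G 1 0 * D₂) + sumFin n (λ i → - sign (toℕ i) *
        (M₁ (fsuc i) fzero * det n (λ a b → M₁ (punchIn (fsuc i) a) (fsuc b))))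
        ≈⟨ +-cong (*-identityˡ _) (sumFin-zero n λ i →
             trans (*-congˡ (*-congʳ (column₀ (toℕ i)))) (trans (*-congˡ (zeroˡ _)) (zeroʳ _))) ⟩
      G 1 0 * D₂ + 0#
        ≈⟨ +-identityʳ _ ⟩
      G 1 0 * D₂ ∎

  -- Jacobi matrices

  tail : (ℕ → Carrier) → ℕ → Carrier
  tail s k = s (suc k)

  atZero : Carrier → ℕ → Carrier
  atZero x zero    = x
  atZero x (suc _) = 0#

  -- defined so that deleting the first row and column gives, definitionally, the Jacobi
  -- matrix of the tails
  jacobi : Carrier → (s t : ℕ → Carrier) → ℕ → ℕ → Carrier
  jacobi γ s t zero    zero    = γ + s 0
  jacobi γ s t zero    (suc l) = atZero 1# l
  jacobi γ s t (suc p) zero    = atZero (t 0) p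
  jacobi γ s t (suc p) (suc l) = jacobi γ (tail s) (tail t) p l

  jacobi-diagonal : ∀ γ s t k → jacobi γ s t k k ≡ γ + s k
  jacobi-diagonal γ s t zero    = ≡.refl
  jacobi-diagonal γ s t (suc k) = jacobi-diagonal γ (tail s) (tail t) k

  jacobi-sub : ∀ γ s t k → jacobi γ s t (suc k) k ≡ t k
  jacobi-sub γ s t zero    = ≡.refl
  jacobi-sub γ s t (suc k) = jacobi-sub γ (tail s) (tail t) k

  jacobi-super : ∀ γ s t k → jacobi γ s t k (suc k) ≡ 1#
  jacobi-super γ s t zero    = ≡.refl
  jacobi-super γ s t (suc k) = jacobi-super γ (tail s) (tail t) k

  jacobi-above : ∀ γ s t p l → suc (suc p) ≤ l → jacobi γ s t p l ≡ 0#
  jacobi-above γ s t zero    (suc (suc l)) _           = ≡.refl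
  jacobi-above γ s t zero    (suc zero)    (s≤s ())
  jacobi-above γ s t (suc p) (suc l)       (s≤s p+2≤l) = jacobi-above γ (tail s) (tail t) p l p+2≤l

  jacobi-below : ∀ γ s t p l → suc (suc l) ≤ p → jacobi γ s t p l ≡ 0#
  jacobi-below γ s t (suc (suc p)) zero    _           = ≡.refl
  jacobi-below γ s t (suc zero)    zero    (s≤s ())
  jacobi-below γ s t (suc p)       (suc l) (s≤s l+2≤p) = jacobi-below γ (tail s) (tail t) p l l+2≤p

  -- f is a continuant, so its recurrence can also be read from the front
  f-expandFirst : ∀ γ n s t →
    f s t γ (suc (suc n)) ≈ (γ + s 0) * f (tail s) (tail t) γ (suc n) - t 0 * f (tail (tail s)) (tail (tail t)) γ n
  f-expandFirst γ zero s t =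
    solve 4 (λ g s₀ s₁ t₀ → (g :+ s₁) :* ((g :+ s₀) :* con 1ℤ) :- t₀ :* con 1ℤ
                          := (g :+ s₀) :* ((g :+ s₁) :* con 1ℤ) :- t₀ :* con 1ℤ) refl γ (s 0) (s 1) (t 0)
  f-expandFirst γ (suc zero) s t =
    solve 6 (λ g s₀ s₁ s₂ t₀ t₁ →
      (g :+ s₂) :* ((g :+ s₁) :* ((g :+ s₀) :* con 1ℤ) :- t₀ :* con 1ℤ) :- t₁ :* ((g :+ s₀) :* con 1ℤ)
      := (g :+ s₀) :* ((g :+ s₂) :* ((g :+ s₁) :* con 1ℤ) :- t₁ :* con 1ℤ) :- t₀ :* ((g :+ s₂) :* con 1ℤ))
      refl γ (s 0) (s 1) (s 2) (t 0) (t 1)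
  f-expandFirst γ (suc (suc n)) s t = begin
    (γ + s (3 +ℕ n)) * f s t γ (3 +ℕ n) - t (2 +ℕ n) * f s t γ (2 +ℕ n)
      ≈⟨ +-cong (*-congˡ (f-expandFirst γ (suc n) s t)) (-‿cong (*-congˡ (f-expandFirst γ n s t))) ⟩
    (γ + s (3 +ℕ n)) * ((γ + s 0) * f₁ (2 +ℕ n) - t 0 * f₂ (suc n))
      - t (2 +ℕ n) * ((γ + s 0) * f₁ (suc n) - t 0 * f₂ n)
      ≈⟨ solve 9 (λ g s₀ sₙ t₀ tₙ a b c d →
            (g :+ sₙ) :* ((g :+ s₀) :* a :- t₀ :* c) :- tₙ :* ((g :+ s₀) :* b :- t₀ :* d)
            := (g :+ s₀) :* ((g :+ sₙ) :* a :- tₙ :* b) :- t₀ :* ((g :+ sₙ) :* c :- tₙ :* d)) refl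
          γ (s 0) (s (3 +ℕ n)) (t 0) (t (2 +ℕ n)) (f₁ (2 +ℕ n)) (f₁ (suc n)) (f₂ (suc n)) (f₂ n) ⟩
    (γ + s 0) * f₁ (3 +ℕ n) - t 0 * f₂ (2 +ℕ n) ∎
    where
    f₁ = f (tail s) (tail t) γ
    f₂ = f (tail (tail s)) (tail (tail t)) γ

  det-jacobi : ∀ γ n s t → det n (toMatrix n (jacobi γ s t)) ≈ f s t γ n
  det-jacobi γ zero          s t = refl
  det-jacobi γ (suc zero)    s t = trans (+-identityʳ _) (*-identityˡ _)
  det-jacobi γ (suc (suc n)) s t = begin
    det (2 +ℕ n) (toMatrix (2 +ℕ n) (jacobi γ s t))
      ≈⟨ det-tridiagonal n (jacobi γ s t) (λ l → refl) (λ p → refl) ⟩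
    (γ + s 0) * det (suc n) (toMatrix (suc n) (jacobi γ (tail s) (tail t)))
      - 1# * t 0 * det n (toMatrix n (jacobi γ (tail (tail s)) (tail (tail t))))
      ≈⟨ +-cong (*-congˡ (det-jacobi γ (suc n) (tail s) (tail t)))
                (-‿cong (*-cong (*-identityˡ _) (det-jacobi γ n (tail (tail s)) (tail (tail t))))) ⟩
    (γ + s 0) * f (tail s) (tail t) γ (suc n) - t 0 * f (tail (tail s)) (tail (tail t)) γ n
      ≈⟨ f-expandFirst γ n s t ⟨
    f s t γ (2 +ℕ n) ∎

  -- u ↦ u J₀ on row vectors: the recurrence defining m(n , k), m(n , -1) = 0 built in
  pathStep : (s t u : ℕ → Carrier) → ℕ → Carrier
  pathStep s t u zero    = s 0 * u 0 + t 0 * u 1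
  pathStep s t u (suc k) = u k + s (suc k) * u (suc k) + t (suc k) * u (suc (suc k))

  pathStep-linear : ∀ s t x (u v : ℕ → Carrier) k →
    pathStep s t (λ l → x * u l + v l) k ≈ x * pathStep s t u k + pathStep s t v k
  pathStep-linear s t x u v zero =
    solve 7 (λ x s₀ t₀ u₀ u₁ v₀ v₁ → s₀ :* (x :* u₀ :+ v₀) :+ t₀ :* (x :* u₁ :+ v₁)
                                    := x :* (s₀ :* u₀ :+ t₀ :* u₁) :+ (s₀ :* v₀ :+ t₀ :* v₁))
      refl x (s 0) (t 0) (u 0) (u 1) (v 0) (v 1)
  pathStep-linear s t x u v (suc k) =
    solve 9 (λ x sₖ tₖ u₀ u₁ u₂ v₀ v₁ v₂ → (x :* u₀ :+ v₀) :+ sₖ :* (x :* u₁ :+ v₁) :+ tₖ :* (x :* u₂ :+ v₂)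
                                          := x :* (u₀ :+ sₖ :* u₁ :+ tₖ :* u₂) :+ (v₀ :+ sₖ :* v₁ :+ tₖ :* v₂))
      refl x (s (suc k)) (t (suc k)) (u k) (u (suc k)) (u (suc (suc k))) (v k) (v (suc k)) (v (suc (suc k)))

  -- column k of J_γ has no entry below row k + 1
  jacobi-column : ∀ γ s t (u : ℕ → Carrier) k →
    sumℕ (suc k) (λ p → u p * jacobi γ s t p k) + u (suc k) * t k ≈ γ * u k + pathStep s t u k
  jacobi-column γ s t u zero =
    solve 5 (λ g s₀ t₀ u₀ u₁ → (con 0ℤ :+ u₀ :* (g :+ s₀)) :+ u₁ :* t₀ := g :* u₀ :+ (s₀ :* u₀ :+ t₀ :* u₁))
      refl γ (s 0) (t 0) (u 0) (u 1)
  jacobi-column γ s t u (suc k) = begin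
    ((sumℕ k g + u k * jacobi γ s t k (suc k)) + u (suc k) * jacobi γ s t (suc k) (suc k))
      + u (suc (suc k)) * t (suc k)
      ≈⟨ +-congʳ (+-cong (+-cong aboveVanishes (*-congˡ (reflexive (jacobi-super γ s t k))))
                          (*-congˡ (reflexive (jacobi-diagonal γ s t (suc k))))) ⟩
    ((0# + u k * 1#) + u (suc k) * (γ + s (suc k))) + u (suc (suc k)) * t (suc k)
      ≈⟨ solve 6 (λ g a b c sₖ tₖ → ((con 0ℤ :+ a :* con 1ℤ) :+ b :* (g :+ sₖ)) :+ c :* tₖ
                                    := g :* b :+ (a :+ sₖ :* b :+ tₖ :* c))
           refl γ (u k) (u (suc k)) (u (suc (suc k))) (s (suc k)) (t (suc k)) ⟩
    γ * u (suc k) + pathStep s t u (suc k) ∎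
    where
    g : ℕ → Carrier
    g p = u p * jacobi γ s t p (suc k)
    aboveVanishes : sumℕ k g ≈ 0#
    aboveVanishes = sumℕ-zero< k λ p p<k →
      trans (*-congˡ (reflexive (jacobi-above γ s t p (suc k) (s≤s p<k)))) (zeroʳ _)

  sumℕ-jacobi : ∀ γ s t (u : ℕ → Carrier) k N → suc (suc k) ≤ N →
    sumℕ N (λ p → u p * jacobi γ s t p k) ≈ γ * u k + pathStep s t u k
  sumℕ-jacobi γ s t u k (suc N) k+2≤N+1 with ℕ.m≤n⇒m<n∨m≡n k+2≤N+1
  ... | inj₂ ≡.refl = trans (+-congˡ (*-congˡ (reflexive (jacobi-sub γ s t k)))) (jacobi-column γ s t u k)
  ... | inj₁ (s≤s k+2≤N) =
    trans (+-congˡ (trans (*-congˡ (reflexive (jacobi-below γ s t N k k+2≤N))) (zeroʳ _)))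
          (trans (+-identityʳ _) (sumℕ-jacobi γ s t u k N k+2≤N))

  sumℕ-jacobi-last : ∀ γ s t (u : ℕ → Carrier) k N → k ℕ.< N → u N ≈ 0# →
    sumℕ N (λ p → u p * jacobi γ s t p k) ≈ γ * u k + pathStep s t u k
  sumℕ-jacobi-last γ s t u k N k<N u_N≈0 with ℕ.m≤n⇒m<n∨m≡n k<N
  ... | inj₁ k+2≤N  = sumℕ-jacobi γ s t u k N k+2≤N
  ... | inj₂ ≡.refl = trans (sym (+-identityʳ _))
                            (trans (+-congˡ (sym (trans (*-congʳ u_N≈0) (zeroˡ _)))) (jacobi-column γ s t u k))

  -- Moments

  module Moments (s t : ℕ → Carrier) where

    μ : ℕ → Carrier
    μ zero    = 1#
    μ (suc k) = μ k * t k

    m-above : ∀ i k → i ℕ.< k → m s t i k ≈ 0#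
    m-above zero    (suc k) _         = refl
    m-above (suc i) (suc k) (s≤s i<k) = begin
      m s t i k + s (suc k) * m s t i (suc k) + t (suc k) * m s t i (suc (suc k))
        ≈⟨ +-cong (+-cong (m-above i k i<k) (*-congˡ (m-above i (suc k) (ℕ.m<n⇒m<1+n i<k))))
                  (*-congˡ (m-above i (suc (suc k)) (ℕ.m<n⇒m<1+n (ℕ.m<n⇒m<1+n i<k)))) ⟩
      0# + s (suc k) * 0# + t (suc k) * 0#
        ≈⟨ solve 2 (λ a b → con 0ℤ :+ a :* con 0ℤ :+ b :* con 0ℤ := con 0ℤ) refl _ _ ⟩
      0# ∎

    m-diagonal : ∀ i → m s t i i ≈ 1#
    m-diagonal zero    = refl
    m-diagonal (suc i) = begin
      m s t i i + s (suc i) * m s t i (suc i) + t (suc i) * m s t i (suc (suc i))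
        ≈⟨ +-cong (+-cong (m-diagonal i) (*-congˡ (m-above i (suc i) ℕ.≤-refl)))
                  (*-congˡ (m-above i (suc (suc i)) (ℕ.m<n⇒m<1+n ℕ.≤-refl))) ⟩
      1# + s (suc i) * 0# + t (suc i) * 0#
        ≈⟨ solve 2 (λ a b → con 1ℤ :+ a :* con 0ℤ :+ b :* con 0ℤ := con 1ℤ) refl _ _ ⟩
      1# ∎

    m-suc : ∀ i k → m s t (suc i) k ≡ pathStep s t (m s t i) k
    m-suc i zero    = ≡.refl
    m-suc i (suc k) = ≡.refl

    previous : (ℕ → Carrier) → ℕ → Carrier
    previous u zero    = 0#
    previous u (suc k) = u k

    pathStep-previous : ∀ u k → pathStep s t u k ≈ previous u k + s k * u k + t k * u (suc k)
    pathStep-previous u zero    = sym (+-congʳ (+-identityˡ _))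
    pathStep-previous u (suc k) = refl

    pairing : ℕ → (u v : ℕ → Carrier) → Carrier
    pairing N u v = sumℕ N (λ k → u k * (μ k * v k))

    -- J₀ is self-adjoint for the weights μ, up to a boundary term at N
    pairing-pathStep : ∀ N u v → pairing N (pathStep s t u) v ≈
      pairing N u (pathStep s t v) + (u N * (μ N * previous v N) - previous u N * (μ N * v N))
    pairing-pathStep zero u v =
      solve 2 (λ a b → con 0ℤ := con 0ℤ :+ (a :* (con 1ℤ :* con 0ℤ) :- con 0ℤ :* (con 1ℤ :* b))) refl (u 0) (v 0)
    pairing-pathStep (suc N) u v = begin
      pairing N (pathStep s t u) v + pathStep s t u N * (μ N * v N)
        ≈⟨ +-cong (pairing-pathStep N u v) (*-congʳ (pathStep-previous u N)) ⟩
      (pairing N u (pathStep s t v) + (u N * (μ N * previous v N) - previous u N * (μ N * v N)))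
        + (previous u N + s N * u N + t N * u (suc N)) * (μ N * v N)
        ≈⟨ solve 10 (λ P uₙ uₙ₊₁ u₋ vₙ vₙ₊₁ v₋ sₙ tₙ w →
             (P :+ (uₙ :* (w :* v₋) :- u₋ :* (w :* vₙ))) :+ (u₋ :+ sₙ :* uₙ :+ tₙ :* uₙ₊₁) :* (w :* vₙ)
             := (P :+ uₙ :* (w :* (v₋ :+ sₙ :* vₙ :+ tₙ :* vₙ₊₁)))
                :+ (uₙ₊₁ :* (w :* tₙ :* vₙ) :- uₙ :* (w :* tₙ :* vₙ₊₁)))
             refl (pairing N u (pathStep s t v)) (u N) (u (suc N)) (previous u N)
                  (v N) (v (suc N)) (previous v N) (s N) (t N) (μ N) ⟩
      (pairing N u (pathStep s t v) + u N * (μ N * (previous v N + s N * v N + t N * v (suc N))))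
        + (u (suc N) * (μ (suc N) * v N) - u N * (μ (suc N) * v (suc N)))
        ≈⟨ +-congʳ (+-congˡ (*-congˡ (*-congˡ (sym (pathStep-previous v N))))) ⟩
      pairing (suc N) u (pathStep s t v)
        + (u (suc N) * (μ (suc N) * previous v (suc N)) - previous u (suc N) * (μ (suc N) * v (suc N))) ∎

    -- induction on j moves one step at a time from the right factor to the left one
    mom-pairing′ : ∀ j i N → i ℕ.< N → j ℕ.< N → mom s t (i +ℕ j) ≈ pairing N (m s t i) (m s t j)
    mom-pairing′ zero i (suc N) _ _ = begin
      mom s t (i +ℕ 0)                  ≡⟨ ≡.cong (mom s t) (ℕ.+-identityʳ i) ⟩
      m s t i 0                         ≈⟨ solve 1 (λ a → a := a :* (con 1ℤ :* con 1ℤ) :+ con 0ℤ) refl _ ⟩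
      m s t i 0 * (1# * 1#) + 0#
        ≈⟨ +-congˡ (sym (sumℕ-zero< N (λ k _ → trans (*-congˡ (zeroʳ _)) (zeroʳ _)))) ⟩
      m s t i 0 * (μ 0 * m s t 0 0) + sumℕ N (λ k → m s t i (suc k) * (μ (suc k) * m s t 0 (suc k)))
        ≈⟨ sumℕ-head N _ ⟨
      pairing (suc N) (m s t i) (m s t 0) ∎
    mom-pairing′ (suc j) i N i<N j+1<N = begin
      mom s t (i +ℕ suc j)
        ≡⟨ ≡.cong (mom s t) (ℕ.+-suc i j) ⟩
      mom s t (suc i +ℕ j)
        ≈⟨ mom-pairing′ j (suc i) (suc N) (s≤s i<N) (ℕ.m<n⇒m<1+n (ℕ.<-trans (ℕ.n<1+n j) j+1<N)) ⟩
      pairing (suc N) (m s t (suc i)) (m s t j)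
        ≈⟨ sumℕ-cong (suc N) (λ k → *-congʳ (reflexive (m-suc i k))) ⟩
      pairing (suc N) (pathStep s t (m s t i)) (m s t j)
        ≈⟨ pairing-pathStep (suc N) (m s t i) (m s t j) ⟩
      pairing (suc N) (m s t i) (pathStep s t (m s t j))
        + (m s t i (suc N) * (μ (suc N) * m s t j N) - m s t i N * (μ (suc N) * m s t j (suc N)))
        ≈⟨ +-cong (sumℕ-cong (suc N) (λ k → *-congˡ (*-congˡ (sym (reflexive (m-suc j k))))))
                  (+-cong (*-congʳ (m-above i (suc N) (ℕ.m<n⇒m<1+n i<N))) (-‿cong (*-congʳ (m-above i N i<N)))) ⟩
      (pairing N (m s t i) (m s t (suc j)) + m s t i N * (μ N * m s t (suc j) N))
        + (0# * (μ (suc N) * m s t j N) - 0# * (μ (suc N) * m s t j (suc N)))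
        ≈⟨ +-congʳ (+-congˡ (*-congʳ (m-above i N i<N))) ⟩
      (pairing N (m s t i) (m s t (suc j)) + 0# * (μ N * m s t (suc j) N))
        + (0# * (μ (suc N) * m s t j N) - 0# * (μ (suc N) * m s t j (suc N)))
        ≈⟨ solve 4 (λ a b c d → (a :+ con 0ℤ :* b) :+ (con 0ℤ :* c :- con 0ℤ :* d) := a) refl _ _ _ _ ⟩
      pairing N (m s t i) (m s t (suc j)) ∎

    pairing-truncate : ∀ d N u v → (∀ k → N ≤ k → u k ≈ 0#) → pairing (d +ℕ N) u v ≈ pairing N u v
    pairing-truncate zero    N u v _      = refl
    pairing-truncate (suc d) N u v u≈0 =
      trans (+-cong (pairing-truncate d N u v u≈0) (trans (*-congʳ (u≈0 (d +ℕ N) (ℕ.m≤n+m N d))) (zeroˡ _)))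
            (+-identityʳ _)

    mom-pairing : ∀ j i N → i ℕ.< N → mom s t (i +ℕ j) ≈ pairing N (m s t i) (m s t j)
    mom-pairing j i N i<N =
      trans (mom-pairing′ j i (j +ℕ N) (ℕ.≤-trans i<N (ℕ.m≤n+m N j)) (ℕ.m<m+n j (ℕ.≤-trans (s≤s z≤n) i<N)))
            (pairing-truncate j N (m s t i) (m s t j) (λ k N≤k → m-above i k (ℕ.<-≤-trans i<N N≤k)))

    pairing-comm : ∀ N u v → pairing N u v ≈ pairing N v u
    pairing-comm N u v = sumℕ-cong N (λ k → solve 3 (λ x y z → x :* (y :* z) := z :* (y :* x)) refl _ _ _)

    mom-pairingˡ : ∀ r i j N → j ℕ.< N → mom s t (r +ℕ (i +ℕ j)) ≈ pairing N (m s t (r +ℕ i)) (m s t j)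
    mom-pairingˡ r i j N j<N = begin
      mom s t (r +ℕ (i +ℕ j))        ≡⟨ ≡.cong (mom s t) (≡.trans (≡.sym (ℕ.+-assoc r i j)) (ℕ.+-comm (r +ℕ i) j)) ⟩
      mom s t (j +ℕ (r +ℕ i))        ≈⟨ mom-pairing (r +ℕ i) j N j<N ⟩
      pairing N (m s t j) (m s t (r +ℕ i)) ≈⟨ pairing-comm N _ _ ⟩
      pairing N (m s t (r +ℕ i)) (m s t j) ∎

    ΔLᵀ : ∀ n → Matrix n
    ΔLᵀ n k j = μ (toℕ k) * m s t (toℕ j) (toℕ k)

    π : ℕ → Carrier
    π n = prodFin n (λ k → μ (toℕ k))

    det-ΔLᵀ : ∀ n → det n (ΔLᵀ n) ≈ π n
    det-ΔLᵀ n = trans (det-upperTriangular n (ΔLᵀ n) (λ k j j<k → trans (*-congˡ (m-above (toℕ j) (toℕ k) j<k)) (zeroʳ _)))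
                      (prodFin-cong n (λ k → trans (*-congˡ (m-diagonal (toℕ k))) (*-identityʳ _)))

    det-L : ∀ n → det n (toMatrix n (m s t)) ≈ 1#
    det-L n = trans (det-lowerTriangular n _ (λ i k i<k → m-above (toℕ i) (toℕ k) i<k))
                    (prodFin-1 n (λ i → m-diagonal (toℕ i)))

    det-*ᴹ-ΔLᵀ : ∀ n (u : ℕ → ℕ → Carrier) (M : Matrix n) →
      (∀ i j → M i j ≈ pairing n (u (toℕ i)) (m s t (toℕ j))) → det n M ≈ π n * det n (toMatrix n u)
    det-*ᴹ-ΔLᵀ n u M M≈ = begin
      det n M                            ≈⟨ det-cong n (λ i j → trans (M≈ i j) (sym (sumFin-toℕ n _))) ⟩
      det n (toMatrix n u *ᴹ ΔLᵀ n)      ≈⟨ det-*ᴹ n (toMatrix n u) (ΔLᵀ n) ⟩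
      det n (ΔLᵀ n) * det n (toMatrix n u) ≈⟨ *-congʳ (det-ΔLᵀ n) ⟩
      π n * det n (toMatrix n u)         ∎

    hankel : ∀ n → Matrix n
    hankel n i j = mom s t (toℕ i +ℕ toℕ j)

    det-hankel : ∀ n → det n (hankel n) ≈ π n
    det-hankel n = trans (det-*ᴹ-ΔLᵀ n (m s t) (hankel n) (λ i j → mom-pairingˡ 0 (toℕ i) (toℕ j) n (toℕ<n j)))
                         (trans (*-congˡ (det-L n)) (*-identityʳ _))

    det-hankel≉0 : (∀ k → ¬ t k ≈ 0#) → ∀ n → ¬ det n (hankel n) ≈ 0#
    det-hankel≉0 t≉0 n H≈0 = prodFin≉0 n (λ k → μ≉0 (toℕ k)) (trans (sym (det-hankel n)) H≈0)
      where
      *-≉0 : ∀ {x y} → ¬ x ≈ 0# → ¬ y ≈ 0# → ¬ x * y ≈ 0#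
      *-≉0 {x} {y} x≉0 y≉0 xy≈0 = x≉0 (begin
        x                 ≈⟨ *-identityʳ x ⟨
        x * 1#            ≈⟨ *-congˡ (inverse y y≉0) ⟨
        x * (y * inv y y≉0) ≈⟨ *-assoc x y _ ⟨
        x * y * inv y y≉0 ≈⟨ *-congʳ xy≈0 ⟩
        0# * inv y y≉0    ≈⟨ zeroˡ _ ⟩
        0#                ∎)
      μ≉0 : ∀ k → ¬ μ k ≈ 0#
      μ≉0 zero    = 1≉0
      μ≉0 (suc k) = *-≉0 (μ≉0 k) (t≉0 k)
      prodFin≉0 : ∀ n {g : Fin n → Carrier} → (∀ i → ¬ g i ≈ 0#) → ¬ prodFin n g ≈ 0#
      prodFin≉0 zero    _   = 1≉0
      prodFin≉0 (suc n) g≉0 = *-≉0 (g≉0 fzero) (prodFin≉0 n (λ i → g≉0 (fsuc i)))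

    module Numerator (α β : Carrier) where

      -- rows of L (J₀ + α) and of L (J₀ + α) (J₀ + β), cf. L*Jα
      mα : ℕ → ℕ → Carrier
      mα j l = α * m s t j l + m s t (suc j) l

      mαβ : ℕ → ℕ → Carrier
      mαβ j k = β * mα j k + mα (suc j) k

      numerator : ∀ n → Matrix n
      numerator n i j = α * β * mom s t (toℕ i +ℕ toℕ j) + (α + β) * mom s t (suc (toℕ i +ℕ toℕ j))
                        + mom s t (suc (suc (toℕ i +ℕ toℕ j)))

      numerator-pairing : ∀ n i j → numerator n i j ≈ pairing n (mαβ (toℕ i)) (m s t (toℕ j))
      numerator-pairing n i j = begin
        numerator n i j
          ≈⟨ +-cong (+-cong (*-congˡ (mom-pairingˡ 0 I J n J<n)) (*-congˡ (mom-pairingˡ 1 I J n J<n)))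
                    (mom-pairingˡ 2 I J n J<n) ⟩
        α * β * pairing n (m s t I) (m s t J) + (α + β) * pairing n (m s t (suc I)) (m s t J)
          + pairing n (m s t (suc (suc I))) (m s t J)
          ≈⟨ +-congʳ (+-cong (*-distribˡ-sumℕ n (α * β) _) (*-distribˡ-sumℕ n (α + β) _)) ⟩
        sumℕ n (λ k → α * β * term I k) + sumℕ n (λ k → (α + β) * term (suc I) k) + pairing n (m s t (suc (suc I))) (m s t J)
          ≈⟨ +-congʳ (sumℕ-+ n (λ k → α * β * term I k) (λ k → (α + β) * term (suc I) k)) ⟨
        sumℕ n (λ k → α * β * term I k + (α + β) * term (suc I) k) + pairing n (m s t (suc (suc I))) (m s t J)
          ≈⟨ sumℕ-+ n (λ k → α * β * term I k + (α + β) * term (suc I) k) (term (suc (suc I))) ⟨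
        sumℕ n (λ k → α * β * term I k + (α + β) * term (suc I) k + term (suc (suc I)) k)
          ≈⟨ sumℕ-cong n (λ k → solve 7 (λ a b x₀ x₁ x₂ w y →
               a :* b :* (x₀ :* (w :* y)) :+ (a :+ b) :* (x₁ :* (w :* y)) :+ x₂ :* (w :* y)
               := (b :* (a :* x₀ :+ x₁) :+ (a :* x₁ :+ x₂)) :* (w :* y)) refl
               α β (m s t I k) (m s t (suc I) k) (m s t (suc (suc I)) k) (μ k) (m s t J k)) ⟩
        pairing n (mαβ I) (m s t J) ∎
        where
        I = toℕ i
        J = toℕ j
        J<n = toℕ<n j
        term : ℕ → ℕ → Carrier
        term r k = m s t r k * (μ k * m s t J k)

      det-numerator : ∀ n → det n (numerator n) ≈ π n * det n (toMatrix n mαβ)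
      det-numerator n = det-*ᴹ-ΔLᵀ n mαβ (numerator n) (numerator-pairing n)

      pathStep-mα : ∀ i k → pathStep s t (mα i) k ≈ mα (suc i) k
      pathStep-mα i k = trans (pathStep-linear s t α (m s t i) (m s t (suc i)) k)
        (reflexive (≡.cong₂ (λ a b → α * a + b) (≡.sym (m-suc i k)) (≡.sym (m-suc (suc i) k))))

      J : Carrier → ∀ N → Matrix N
      J γ N = toMatrix N (jacobi γ s t)

      L*Jα : ∀ N (i l : Fin N) → (toMatrix N (m s t) *ᴹ J α N) i l ≈ mα (toℕ i) (toℕ l)
      L*Jα N i l = begin
        sumFin N (λ p → m s t (toℕ i) (toℕ p) * jacobi α s t (toℕ p) (toℕ l))
          ≈⟨ sumFin-toℕ N (λ p → m s t (toℕ i) p * jacobi α s t p (toℕ l)) ⟩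
        sumℕ N (λ p → m s t (toℕ i) p * jacobi α s t p (toℕ l))
          ≈⟨ sumℕ-jacobi-last α s t (m s t (toℕ i)) (toℕ l) N (toℕ<n l) (m-above (toℕ i) N (toℕ<n i)) ⟩
        α * m s t (toℕ i) (toℕ l) + pathStep s t (m s t (toℕ i)) (toℕ l)
          ≡⟨ ≡.cong (λ z → α * m s t (toℕ i) (toℕ l) + z) (m-suc (toℕ i) (toℕ l)) ⟨
        mα (toℕ i) (toℕ l) ∎

      L*Jα*Jβ : ∀ N → Matrix N
      L*Jα*Jβ N = toMatrix N (m s t) *ᴹ J α N *ᴹ J β N

      L*Jα*Jβ-entry : ∀ N (i k : Fin N) → L*Jα*Jβ N i k ≈ sumℕ N (λ l → mα (toℕ i) l * jacobi β s t l (toℕ k))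
      L*Jα*Jβ-entry N i k = trans (sumFin-cong N (λ l → *-congʳ (L*Jα N i l)))
                                  (sumFin-toℕ N (λ l → mα (toℕ i) l * jacobi β s t l (toℕ k)))

      -- away from the last column the truncation of the product to N × N is invisible
      L*Jα*Jβ-inner : ∀ N (i k : Fin N) → suc (suc (toℕ k)) ≤ N → L*Jα*Jβ N i k ≈ mαβ (toℕ i) (toℕ k)
      L*Jα*Jβ-inner N i k k+2≤N = trans (L*Jα*Jβ-entry N i k)
        (trans (sumℕ-jacobi β s t (mα (toℕ i)) (toℕ k) N k+2≤N) (+-congˡ (pathStep-mα (toℕ i) (toℕ k))))

      mα-beyond : ∀ n (i : Fin (suc n)) → mα (toℕ i) (suc n) ≈ 1ᴹ i (fromℕ n)
      mα-beyond n i with toℕ i ℕ.≟ n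
      ... | yes i≡n = begin
        α * m s t (toℕ i) (suc n) + m s t (suc (toℕ i)) (suc n)
          ≈⟨ +-cong (*-congˡ (m-above (toℕ i) (suc n) (toℕ<n i)))
                    (reflexive (≡.cong (λ z → m s t (suc z) (suc n)) i≡n)) ⟩
        α * 0# + m s t (suc n) (suc n)     ≈⟨ +-cong (zeroʳ α) (m-diagonal (suc n)) ⟩
        0# + 1#                            ≈⟨ +-identityˡ 1# ⟩
        1#                                 ≡⟨ 1ᴹ-fromℕ i i≡n ⟨
        1ᴹ i (fromℕ n)                     ∎
      ... | no i≢n = begin
        α * m s t (toℕ i) (suc n) + m s t (suc (toℕ i)) (suc n)
          ≈⟨ +-cong (*-congˡ (m-above (toℕ i) (suc n) (toℕ<n i)))
                    (m-above (suc (toℕ i)) (suc n) (s≤s (ℕ.≤∧≢⇒< (ℕ.≤-pred (toℕ<n i)) i≢n))) ⟩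
        α * 0# + 0#                        ≈⟨ trans (+-identityʳ _) (zeroʳ α) ⟩
        0#                                 ≡⟨ 1ᴹ-fromℕ-≢ i i≢n ⟨
        1ᴹ i (fromℕ n)                     ∎

      L*Jα*Jβ-last : ∀ n (i : Fin (suc n)) →
        mαβ (toℕ i) n ≈ L*Jα*Jβ (suc n) i (fromℕ n) + t n * 1ᴹ i (fromℕ n)
      L*Jα*Jβ-last n i = begin
        β * mα (toℕ i) n + mα (suc (toℕ i)) n
          ≈⟨ +-congˡ (pathStep-mα (toℕ i) n) ⟨
        β * mα (toℕ i) n + pathStep s t (mα (toℕ i)) n
          ≈⟨ jacobi-column β s t (mα (toℕ i)) n ⟨
        sumℕ (suc n) (λ l → mα (toℕ i) l * jacobi β s t l n) + mα (toℕ i) (suc n) * t n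
          ≈⟨ +-cong (sym (trans (L*Jα*Jβ-entry (suc n) i (fromℕ n))
                      (reflexive (≡.cong (λ k → sumℕ (suc n) (λ l → mα (toℕ i) l * jacobi β s t l k)) (toℕ-fromℕ n)))))
                    (trans (*-comm _ _) (*-congˡ (mα-beyond n i))) ⟩
        L*Jα*Jβ (suc n) i (fromℕ n) + t n * 1ᴹ i (fromℕ n) ∎

      det-L*Jα*Jβ : ∀ N → det N (L*Jα*Jβ N) ≈ f s t β N * f s t α N
      det-L*Jα*Jβ N = begin
        det N (L*Jα*Jβ N)                                        ≈⟨ det-*ᴹ N (L *ᴹ J α N) (J β N) ⟩
        det N (J β N) * det N (L *ᴹ J α N)                       ≈⟨ *-cong (det-jacobi β N s t) (det-*ᴹ N L (J α N)) ⟩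
        f s t β N * (det N (J α N) * det N L)                    ≈⟨ *-congˡ (*-cong (det-jacobi α N s t) (det-L N)) ⟩
        f s t β N * (f s t α N * 1#)                             ≈⟨ *-congˡ (*-identityʳ _) ⟩
        f s t β N * f s t α N                                    ∎
        where L = toMatrix N (m s t)

      -- (mαβ) and L Jα Jβ differ only in the last column, by t n times the last unit vector
      det-mαβ-suc : ∀ n → det (suc n) (toMatrix (suc n) mαβ) ≈
        f s t β (suc n) * f s t α (suc n) + t n * det n (toMatrix n mαβ)
      det-mαβ-suc n = begin
        det N (toMatrix N mαβ)
          ≈⟨ linear-replaceColumn (det-alternatingForm N) (toMatrix N mαβ) (L*Jα*Jβ N) last (t n) e inner lastColumn ⟩
        det N (L*Jα*Jβ N) + t n * det N (replaceColumn last e (L*Jα*Jβ N))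
          ≈⟨ +-cong (det-L*Jα*Jβ N) (*-congˡ det-replaced) ⟩
        f s t β N * f s t α N + t n * det n (toMatrix n mαβ) ∎
        where
        N = suc n
        last = fromℕ n
        e : Fin N → Carrier
        e i = 1ᴹ i last
        inner : ∀ i j → j ≢ last → mαβ (toℕ i) (toℕ j) ≈ L*Jα*Jβ N i j
        inner i j j≢last = sym (L*Jα*Jβ-inner N i j (s≤s (ℕ.≤∧≢⇒< (ℕ.≤-pred (toℕ<n j))
          (λ j≡n → j≢last (toℕ-injective (≡.trans j≡n (≡.sym (toℕ-fromℕ n))))))))
        lastColumn : ∀ i → mαβ (toℕ i) (toℕ last) ≈ L*Jα*Jβ N i last + t n * e i
        lastColumn i = trans (reflexive (≡.cong (mαβ (toℕ i)) (toℕ-fromℕ n))) (L*Jα*Jβ-last n i)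
        det-replaced : det N (replaceColumn last e (L*Jα*Jβ N)) ≈ det n (toMatrix n mαβ)
        det-replaced = trans (det-lastColumnUnit n (replaceColumn last e (L*Jα*Jβ N)) (replaceColumn-same last e (L*Jα*Jβ N)))
          (det-cong n λ i j → begin
            replaceColumn last e (L*Jα*Jβ N) (inject₁ i) (inject₁ j)
              ≈⟨ replaceColumn-other last e (L*Jα*Jβ N) (inject₁ i) (inject₁ j) (inject₁≢last j) ⟩
            L*Jα*Jβ N (inject₁ i) (inject₁ j)
              ≈⟨ inner (inject₁ i) (inject₁ j) (inject₁≢last j) ⟨
            mαβ (toℕ (inject₁ i)) (toℕ (inject₁ j))
              ≡⟨ ≡.cong₂ mαβ (toℕ-inject₁ i) (toℕ-inject₁ j) ⟩
            mαβ (toℕ i) (toℕ j) ∎)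
          where
          inject₁≢last : ∀ j → inject₁ j ≢ last
          inject₁≢last j e = fromℕ≢inject₁ (≡.sym e)

      kernelSum : ℕ → Carrier
      kernelSum n = sumℕ (suc n) (λ j → f s t α j * f s t β j * prodRange t j (n ∸ℕ j))

      kernelSum-suc : ∀ n → kernelSum (suc n) ≈ kernelSum n * t n + f s t α (suc n) * f s t β (suc n)
      kernelSum-suc n = begin
        sumℕ (suc n) (λ j → fαβ j * prodRange t j (suc n ∸ℕ j)) + fαβ (suc n) * prodRange t (suc n) (n ∸ℕ n)
          ≈⟨ +-cong (sumℕ-cong< (suc n) longer) (trans (*-congˡ (reflexive (≡.cong (prodRange t (suc n)) (ℕ.n∸n≡0 n))))
                                                       (*-identityʳ _)) ⟩
        sumℕ (suc n) (λ j → t n * (fαβ j * prodRange t j (n ∸ℕ j))) + fαβ (suc n)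
          ≈⟨ +-congʳ (trans (sym (*-distribˡ-sumℕ (suc n) (t n) _)) (*-comm _ _)) ⟩
        kernelSum n * t n + fαβ (suc n) ∎
        where
        fαβ : ℕ → Carrier
        fαβ j = f s t α j * f s t β j
        longer : ∀ j → j ℕ.< suc n → fαβ j * prodRange t j (suc n ∸ℕ j) ≈ t n * (fαβ j * prodRange t j (n ∸ℕ j))
        longer j j<n+1 = begin
          fαβ j * prodRange t j (suc n ∸ℕ j)
            ≡⟨ ≡.cong (λ z → fαβ j * prodRange t j z) (ℕ.+-∸-assoc 1 j≤n) ⟩
          fαβ j * prodRange t j (suc (n ∸ℕ j))
            ≈⟨ *-congˡ (prodRange-suc t j (n ∸ℕ j)) ⟩
          fαβ j * (prodRange t j (n ∸ℕ j) * t (j +ℕ (n ∸ℕ j)))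
            ≡⟨ ≡.cong (λ z → fαβ j * (prodRange t j (n ∸ℕ j) * t z)) (ℕ.m+[n∸m]≡n j≤n) ⟩
          fαβ j * (prodRange t j (n ∸ℕ j) * t n)
            ≈⟨ solve 3 (λ a p x → a :* (p :* x) := x :* (a :* p)) refl _ _ _ ⟩
          t n * (fαβ j * prodRange t j (n ∸ℕ j)) ∎
          where j≤n = ℕ.≤-pred j<n+1

      det-mαβ : ∀ n → det n (toMatrix n mαβ) ≈ kernelSum n
      det-mαβ zero    = solve 0 (con 1ℤ := con 0ℤ :+ con 1ℤ :* con 1ℤ :* con 1ℤ) refl
      det-mαβ (suc n) = begin
        det (suc n) (toMatrix (suc n) mαβ)
          ≈⟨ det-mαβ-suc n ⟩
        f s t β (suc n) * f s t α (suc n) + t n * det n (toMatrix n mαβ)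
          ≈⟨ +-congˡ (*-congˡ (det-mαβ n)) ⟩
        f s t β (suc n) * f s t α (suc n) + t n * kernelSum n
          ≈⟨ solve 4 (λ b a x q → b :* a :+ x :* q := q :* x :+ a :* b) refl _ _ _ _ ⟩
        kernelSum n * t n + f s t α (suc n) * f s t β (suc n)
          ≈⟨ kernelSum-suc n ⟨
        kernelSum (suc n) ∎

      hankel-ratio : ∀ n (H≉0 : ¬ det n (hankel n) ≈ 0#) →
        det n (numerator n) * inv (det n (hankel n)) H≉0 ≈
        sumFin (suc n) (λ j → f s t α (toℕ j) * f s t β (toℕ j) * prodRange t (toℕ j) (n ∸ℕ toℕ j))
      hankel-ratio n H≉0 = begin
        det n (numerator n) * H⁻¹                  ≈⟨ *-congʳ (det-numerator n) ⟩
        π n * det n (toMatrix n mαβ) * H⁻¹          ≈⟨ *-congʳ (*-cong (sym (det-hankel n)) (det-mαβ n)) ⟩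
        H * kernelSum n * H⁻¹                        ≈⟨ solve 3 (λ h k i → h :* k :* i := k :* (h :* i)) refl _ _ _ ⟩
        kernelSum n * (H * H⁻¹)                      ≈⟨ *-congˡ (inverse H H≉0) ⟩
        kernelSum n * 1#                             ≈⟨ *-identityʳ _ ⟩
        kernelSum n                                  ≈⟨ sumFin-toℕ (suc n) _ ⟨
        sumFin (suc n) (λ j → f s t α (toℕ j) * f s t β (toℕ j) * prodRange t (toℕ j) (n ∸ℕ toℕ j)) ∎
        where
        H = det n (hankel n)
        H⁻¹ = inv H H≉0

theorem1 : ∀ {c ℓ : Level} (F : Field c ℓ) →
    let open Field F in
    let open Over F in
    (s t : ℕ → Carrier) → (∀ k → ¬ (t k ≈ 0#)) →
    (α β : Carrier) → (n : ℕ) → 1 ≤ n →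
    Σ (¬ (det n (λ i j → mom s t (toℕ i +ℕ toℕ j)) ≈ 0#)) (λ nz →
      det n (λ i j → α * β * mom s t (toℕ i +ℕ toℕ j)
                     + (α + β) * mom s t (suc (toℕ i +ℕ toℕ j))
                     + mom s t (suc (suc (toℕ i +ℕ toℕ j))))
        * inv (det n (λ i j → mom s t (toℕ i +ℕ toℕ j))) nz
      ≈ sumFin (suc n) (λ j → f s t α (toℕ j) * f s t β (toℕ j)
                             * prodRange t (toℕ j) (n ∸ℕ toℕ j)))
theorem1 F s t t≉0 α β n _ = H≉0 , Moments.Numerator.hankel-ratio F s t α β n H≉0
  where H≉0 = Moments.det-hankel≉0 F s t t≉0 n
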